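{- Let $n\ge 1$. (1) For every $\sigma \in \mathrm{CUP}(n)$, the necklace $\phi(\sigma) := \langle A(\sigma)\rangle$ belongs to $\tilde N^+(n)$. (2) The resulting map $\phi : \mathrm{CUP}(n) \to \tilde N^+(n)$ is a bijection.
   Context: $\mathrm{CUP}(n)$ is the set of cyclic unimodal permutations of $\{1,\ldots,n\}$: $\sigma$ is a single $n$-cycle and there is $1\le m\le n$ such that $\sigma$ is decreasing on $[1,m]$ and increasing on $[m,n]$. For $\sigma\in\mathrm{CUP}(n)$ let $m$ be the unique element with $\sigma(m)=1$. The itinerary $\mathrm{Itin}(\sigma)\in\{+,-,\star\}^n$ has $\mathrm{Itin}(\sigma)_n=\star$ and, for $1\le i\le n-1$, $\mathrm{Itin}(\sigma)_i=+$ if $\sigma^i(m)>m$ and $-$ if $\sigma^i(m)<m$. $A(\sigma)\in\{0,1\}^n$ is obtained by replacing $+$ by $0$, $-$ by $1$, and $\star$ by the unique digit making the total number of $1$'s even. For $s\in\{0,1\}^n$, $\langle s\rangle$ is its orbit under cyclic rotation; $s$ is primitive if no nontrivial rotation fixes it. $\tilde N^+(n)$ is the set of necklaces $\langle s\rangle$ of length $n$ such that either $s$ is primitive with an even number of $1$'s, or ($n$ even and) $s=s's'$ with $s'\in\{0,1\}^{n/2}$ primitive having an odd number of $1$'s. -}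

module Defs where

open import Data.Nat using (ℕ; zero; suc; _∸_; _<_; _<ᵇ_)
open import Data.Nat.Divisibility using (_∣_)
open import Data.Bool using (Bool; true; false; _xor_; if_then_else_)
open import Data.Fin using (Fin; toℕ) renaming (zero to fzero; _<_ to _<ᶠ_; _≤_ to _≤ᶠ_)
open import Data.Fin.Permutation using (Permutation′; _⟨$⟩ʳ_; _⟨$⟩ˡ_)
open import Data.List using (List; []; _∷_; _++_; [_]; map; upTo; length; foldr)
open import Data.Nat.ListAction using (sum)
open import Data.Product using (Σ; _×_; ∃; ∃-syntax)
open import Data.Sum using (_⊎_)
open import Relation.Binary.PropositionalEquality using (_≡_; _≢_)
open import Function using (_∘_)

-- Permutations of {1..n} are modelled as permutations of Fin n
-- (element i of {1..n} is  Fin index i-1; orders agree).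

_^_·_ : ∀ {n} → Permutation′ n → ℕ → Fin n → Fin n
σ ^ zero  · x = x
σ ^ suc k · x = σ ⟨$⟩ʳ (σ ^ k · x)

-- σ is a single n-cycle: the cyclic group generated by σ acts
-- transitively on {1..n}
IsSingleCycle : ∀ {n} → Permutation′ n → Set
IsSingleCycle {n} σ = ∀ (x y : Fin n) → ∃[ k ] (σ ^ k · x ≡ y)

IsUnimodal : ∀ {n} → Permutation′ n → Set
IsUnimodal {n} σ = Σ (Fin n) λ m →
  ( (∀ (i j : Fin n) → i <ᶠ j → j ≤ᶠ m → (σ ⟨$⟩ʳ j) <ᶠ (σ ⟨$⟩ʳ i))
  × (∀ (i j : Fin n) → m ≤ᶠ i → i <ᶠ j → (σ ⟨$⟩ʳ i) <ᶠ (σ ⟨$⟩ʳ j)) )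

IsCUP : ∀ {n} → Permutation′ n → Set
IsCUP σ = IsSingleCycle σ × IsUnimodal σ

-- Binary words (lists of bits, true = 1, false = 0)

parity : List Bool → Bool
parity = foldr _xor_ false

ones : List Bool → ℕ
ones = sum ∘ map (λ b → if b then 1 else 0)

EvenOnes : List Bool → Set
EvenOnes s = 2 ∣ ones s

OddOnes : List Bool → Set
OddOnes s = 2 ∣ suc (ones s)

rot1 : List Bool → List Bool
rot1 []       = []
rot1 (x ∷ xs) = xs ++ [ x ]

rot : ℕ → List Bool → List Bool
rot zero    s = s
rot (suc r) s = rot r (rot1 s)

_∼_ : List Bool → List Bool → Set
s ∼ t = ∃[ r ] (rot r s ≡ t)

Primitive : List Bool → Set
Primitive s = ∀ r → 0 < r → r < length s → rot r s ≢ s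

InÑ⁺ : List Bool → Set
InÑ⁺ s = (Primitive s × EvenOnes s)
       ⊎ (Σ (List Bool) λ s′ → s ≡ s′ ++ s′ × Primitive s′ × OddOnes s′)

module _ {k : ℕ} (σ : Permutation′ (suc k)) where

  mPt : Fin (suc k)
  mPt = σ ⟨$⟩ˡ fzero

  -- A(σ)_i for 1 ≤ i ≤ n-1: 0 if σ^i(m) > m ('+'), 1 if σ^i(m) < m ('-')
  itinBit : ℕ → Bool
  itinBit i = toℕ (σ ^ i · mPt) <ᵇ toℕ mPt

  Ainit : List Bool
  Ainit = map itinBit (map suc (upTo k))

  -- A(σ): the ⋆ is replaced by the digit making the number of 1's even
  A : List Bool
  A = Ainit ++ [ parity Ainit ]

-- Kneading theory. Give each point p of σ ∈ CUP(n) the itinerary of letters L, ⋆, R telling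
-- whether σ^t(p) lies left of, at, or right of the turning point m, and compare itineraries
-- lexicographically with the orientation reversed after each L (σ decreases left of m): this
-- order is the order of the points. The itinerary of σ(m) = 1, the least point, is A(σ) with
-- its last digit replaced by ⋆, so it is strictly below all its shifts. For a starred word
-- this is equivalent to the 0/1 word being weakly below all its rotations with every proper
-- period leaving an odd complement, which for even words is exactly membership in Ñ⁺(n).
-- Injectivity: a necklace has one least rotation, so A(σ) fixes all itineraries, hence the
-- order of all points along the orbit of m, hence σ. Surjectivity: star the least rotation of
-- s ∈ Ñ⁺(n); sending the rank of each of its shifts to the rank of the next one is a cyclic
-- unimodal permutation whose itinerary of 1 is that starred word.

module Submission where

open import Defs
open import Data.Nat using (ℕ; zero; suc; _+_; _*_; _∸_; _<_; _≤_; z≤n; s≤s; s≤s⁻¹; z<s; _<?_; _<ᵇ_; _≡ᵇ_; NonZero; >-nonZero)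
open import Data.Nat.Properties
open import Data.Nat.Induction using (<-rec)
open import Data.Nat.DivMod using (_%_; _/_; m%n<n; m≡m%n+[m/n]*n; [m+n]%n≡m%n; m≤n⇒m%n≡m)
open import Algebra.Properties.CommutativeSemigroup +-commutativeSemigroup using () renaming (x∙yz≈y∙xz to m+[n+o]≡n+[m+o])
open import Data.Nat.Divisibility using (_∣_; divides; n∣n; ∣1⇒≡1; ∣m∣n⇒∣m+n; ∣m+n∣m⇒∣n)
import Data.Bool
open import Data.Bool using (Bool; true; false; not; _xor_; if_then_else_)
open import Data.Bool.Properties using (xor-assoc; xor-comm; xor-same; xor-identityʳ; not-involutive; not-injective)
open import Data.Fin using (Fin; toℕ; fromℕ<; opposite) renaming (zero to fzero)
open import Data.Fin.Properties using (toℕ-injective; toℕ<n; toℕ-fromℕ<; fromℕ<-toℕ; pigeonhole; injective⇒≤; punchOut-injective; any?; opposite-prop; opposite-involutive)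
open import Data.Fin.Permutation using (Permutation′; permutation; _⟨$⟩ʳ_; _⟨$⟩ˡ_; inverseˡ; inverseʳ)
open import Data.List using (List; []; _∷_; _++_; [_]; map; applyUpTo; length; take; drop)
open import Data.List.Properties using (++-assoc; ++-identityʳ; length-++; length-take; length-drop; take++drop≡id; take-[]; ∷ʳ-injective; ≡-dec; length-applyUpTo; map-applyUpTo; map-upTo)
open import Data.Product using (Σ; _×_; _,_; proj₁; proj₂; ∃-syntax)
open import Data.Sum using (_⊎_; inj₁; inj₂; [_,_]′)
open import Data.Empty using (⊥; ⊥-elim)
open import Function using (_∘_)
open import Relation.Nullary using (¬_; Dec; yes; no)
open import Relation.Binary using (DecidableEquality; Tri; tri<; tri≈; tri>)
open import Relation.Binary.PropositionalEquality using (_≡_; _≢_; refl; sym; trans; cong; cong₂; subst; subst₂; module ≡-Reasoning)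
open ≡-Reasoning


-- Periodic sequences

shift : {A : Set} → ℕ → (ℕ → A) → ℕ → A
shift j a t = a (j + t)

Periodic : {A : Set} → ℕ → (ℕ → A) → Set
Periodic n f = ∀ t → f (n + t) ≡ f t

AgreeBelow : {A : Set} → ℕ → (ℕ → A) → (ℕ → A) → Set
AgreeBelow N a b = ∀ t → t < N → a t ≡ b t

module _ {A : Set} {n : ℕ} {f : ℕ → A} (f-periodic : Periodic n f) where

  periodic-+* : ∀ r q → f (r + q * n) ≡ f r
  periodic-+* r zero    = cong f (+-identityʳ r)
  periodic-+* r (suc q) = trans (cong f (m+[n+o]≡n+[m+o] r n (q * n))) (trans (f-periodic _) (periodic-+* r q))

  periodic-% : .{{_ : NonZero n}} → ∀ t → f t ≡ f (t % n)
  periodic-% t = trans (cong f (m≡m%n+[m/n]*n t n)) (periodic-+* (t % n) (t / n))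

  periodic-shift : ∀ j → Periodic n (shift j f)
  periodic-shift j t = trans (cong f (m+[n+o]≡n+[m+o] j n t)) (f-periodic (j + t))

periodic-ext : ∀ {A : Set} {n} .{{_ : NonZero n}} {f g : ℕ → A} → Periodic n f → Periodic n g →
  AgreeBelow n f g → ∀ t → f t ≡ g t
periodic-ext {n = n} f-per g-per ag t =
  trans (periodic-% f-per t) (trans (ag (t % n) (m%n<n t n)) (sym (periodic-% g-per t)))

agreeBelow-suc : ∀ {A : Set} {N} {a b : ℕ → A} → AgreeBelow (suc N) a b → AgreeBelow N (a ∘ suc) (b ∘ suc)
agreeBelow-suc ag t t<N = ag (suc t) (s≤s t<N)

agreeBelow-∷ : ∀ {A : Set} {N} {a b : ℕ → A} → a 0 ≡ b 0 → AgreeBelow N (a ∘ suc) (b ∘ suc) →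
  AgreeBelow (suc N) a b
agreeBelow-∷ a0≡b0 ag zero    _         = a0≡b0
agreeBelow-∷ a0≡b0 ag (suc t) (s≤s t<N) = ag t t<N

agreeBelow-≤ : ∀ {A : Set} {M N} {a b : ℕ → A} → M ≤ N → AgreeBelow N a b → AgreeBelow M a b
agreeBelow-≤ M≤N ag t t<M = ag t (<-≤-trans t<M M≤N)


-- Letters and the parity-lexicographic order

data Letter : Set where
  L ⋆ R : Letter

_≟ᴸ_ : DecidableEquality Letter
L ≟ᴸ L = yes refl
L ≟ᴸ ⋆ = no λ ()
L ≟ᴸ R = no λ ()
⋆ ≟ᴸ L = no λ ()
⋆ ≟ᴸ ⋆ = yes refl
⋆ ≟ᴸ R = no λ ()
R ≟ᴸ L = no λ ()
R ≟ᴸ ⋆ = no λ ()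
R ≟ᴸ R = yes refl

Stream : Set
Stream = ℕ → Letter

data Order : Set where
  lt eq gt : Order

lt≢eq : lt ≢ eq
lt≢eq ()

gt≢eq : gt ≢ eq
gt≢eq ()

lt≢gt : lt ≢ gt
lt≢gt ()

invert : Order → Order
invert lt = gt
invert eq = eq
invert gt = lt

invert-involutive : ∀ o → invert (invert o) ≡ o
invert-involutive lt = refl
invert-involutive eq = refl
invert-involutive gt = refl

-- An orientation is a Bool, true meaning reversed. Passing through L reverses it,
-- since a unimodal map is decreasing to the left of its turning point ⋆.
reverses : Letter → Bool
reverses L = true
reverses ⋆ = false
reverses R = false

ascending : Bool → Order
ascending false = lt
ascending true  = gt

ascending≢eq : ∀ f → ascending f ≢ eq
ascending≢eq false ()
ascending≢eq true  ()

ascending-not : ∀ f → ascending (not f) ≡ invert (ascending f)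
ascending-not false = refl
ascending-not true  = refl

compareLetters : Bool → Letter → Letter → Order
compareLetters f L L = eq
compareLetters f ⋆ ⋆ = eq
compareLetters f R R = eq
compareLetters f L ⋆ = ascending f
compareLetters f L R = ascending f
compareLetters f ⋆ R = ascending f
compareLetters f ⋆ L = ascending (not f)
compareLetters f R L = ascending (not f)
compareLetters f R ⋆ = ascending (not f)

mutual
  plexCompare : ℕ → Bool → Stream → Stream → Order
  plexCompare zero    f a b = eq
  plexCompare (suc N) f a b = plexStep N f (a 0) (b 0) (a ∘ suc) (b ∘ suc)

  plexStep : ℕ → Bool → Letter → Letter → Stream → Stream → Order
  plexStep N f L L a b = plexCompare N (not f) a b
  plexStep N f ⋆ ⋆ a b = plexCompare N f a b
  plexStep N f R R a b = plexCompare N f a b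
  plexStep N f x y a b = compareLetters f x y

plexStep-distinct : ∀ N f x y a b → x ≢ y → plexStep N f x y a b ≡ compareLetters f x y
plexStep-distinct N f L L a b x≢y = ⊥-elim (x≢y refl)
plexStep-distinct N f ⋆ ⋆ a b x≢y = ⊥-elim (x≢y refl)
plexStep-distinct N f R R a b x≢y = ⊥-elim (x≢y refl)
plexStep-distinct N f L ⋆ a b x≢y = refl
plexStep-distinct N f L R a b x≢y = refl
plexStep-distinct N f ⋆ L a b x≢y = refl
plexStep-distinct N f ⋆ R a b x≢y = refl
plexStep-distinct N f R L a b x≢y = refl
plexStep-distinct N f R ⋆ a b x≢y = refl

plexStep-same : ∀ N f x a b → plexStep N f x x a b ≡ plexCompare N (reverses x xor f) a b
plexStep-same N f L a b = refl
plexStep-same N f ⋆ a b = refl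
plexStep-same N f R a b = refl

compareLetters-distinct : ∀ f x y → x ≢ y → compareLetters f x y ≢ eq
compareLetters-distinct f L L x≢y = ⊥-elim (x≢y refl)
compareLetters-distinct f ⋆ ⋆ x≢y = ⊥-elim (x≢y refl)
compareLetters-distinct f R R x≢y = ⊥-elim (x≢y refl)
compareLetters-distinct f L ⋆ x≢y = ascending≢eq f
compareLetters-distinct f L R x≢y = ascending≢eq f
compareLetters-distinct f ⋆ R x≢y = ascending≢eq f
compareLetters-distinct f ⋆ L x≢y = ascending≢eq (not f)
compareLetters-distinct f R L x≢y = ascending≢eq (not f)
compareLetters-distinct f R ⋆ x≢y = ascending≢eq (not f)

invert-ascending-not : ∀ f → invert (ascending (not f)) ≡ ascending f
invert-ascending-not f = trans (cong invert (ascending-not f)) (invert-involutive (ascending f))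

compareLetters-swap : ∀ f x y → compareLetters f x y ≡ invert (compareLetters f y x)
compareLetters-swap f L L = refl
compareLetters-swap f ⋆ ⋆ = refl
compareLetters-swap f R R = refl
compareLetters-swap f L ⋆ = sym (invert-ascending-not f)
compareLetters-swap f L R = sym (invert-ascending-not f)
compareLetters-swap f ⋆ R = sym (invert-ascending-not f)
compareLetters-swap f ⋆ L = ascending-not f
compareLetters-swap f R L = ascending-not f
compareLetters-swap f R ⋆ = ascending-not f

compareLetters-not : ∀ f x y → compareLetters (not f) x y ≡ invert (compareLetters f x y)
compareLetters-not f L L = refl
compareLetters-not f ⋆ ⋆ = refl
compareLetters-not f R R = refl
compareLetters-not f L ⋆ = ascending-not f
compareLetters-not f L R = ascending-not f
compareLetters-not f ⋆ R = ascending-not f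
compareLetters-not f ⋆ L = trans (cong ascending (not-involutive f)) (sym (invert-ascending-not f))
compareLetters-not f R L = trans (cong ascending (not-involutive f)) (sym (invert-ascending-not f))
compareLetters-not f R ⋆ = trans (cong ascending (not-involutive f)) (sym (invert-ascending-not f))

compareLetters-not-swap : ∀ f x y → compareLetters (not f) x y ≡ compareLetters f y x
compareLetters-not-swap f x y =
  trans (compareLetters-not f x y)
        (trans (cong invert (compareLetters-swap f x y)) (invert-involutive (compareLetters f y x)))

lParity : ℕ → Stream → Bool
lParity zero    a = false
lParity (suc d) a = reverses (a 0) xor lParity d (a ∘ suc)

lParity-cong : ∀ d {a b} → AgreeBelow d a b → lParity d a ≡ lParity d b
lParity-cong zero    ag = refl
lParity-cong (suc d) ag = cong₂ (λ x p → reverses x xor p) (ag 0 z<s) (lParity-cong d (agreeBelow-suc ag))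

lParity-+ : ∀ p q a → lParity (p + q) a ≡ lParity p a xor lParity q (shift p a)
lParity-+ zero    q a = refl
lParity-+ (suc p) q a =
  trans (cong (reverses (a 0) xor_) (lParity-+ p q (a ∘ suc)))
        (sym (xor-assoc (reverses (a 0)) (lParity p (a ∘ suc)) _))

lParity-suc : ∀ d a → lParity (suc d) a ≡ lParity d a xor reverses (a d)
lParity-suc zero    a = xor-comm (reverses (a 0)) false
lParity-suc (suc d) a =
  trans (cong (reverses (a 0) xor_) (lParity-suc d (a ∘ suc)))
        (sym (xor-assoc (reverses (a 0)) (lParity d (a ∘ suc)) _))

plexCompare-firstDifference : ∀ d N f a b → d < N → AgreeBelow d a b → a d ≢ b d →
  plexCompare N f a b ≡ compareLetters (lParity d a xor f) (a d) (b d)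
plexCompare-firstDifference zero (suc N) f a b _ _ a0≢b0 =
  plexStep-distinct N f (a 0) (b 0) (a ∘ suc) (b ∘ suc) a0≢b0
plexCompare-firstDifference (suc d) (suc N) f a b (s≤s d<N) ag ad≢bd
  rewrite sym (ag 0 z<s) =
  trans (plexStep-same N f (a 0) (a ∘ suc) (b ∘ suc))
   (trans (plexCompare-firstDifference d N (reverses (a 0) xor f) (a ∘ suc) (b ∘ suc) d<N (agreeBelow-suc ag) ad≢bd)
          (cong (λ g → compareLetters g (a (suc d)) (b (suc d))) (xor-rearrange (reverses (a 0)) (lParity d (a ∘ suc)) f)))
  where
  xor-rearrange : ∀ x p f → p xor (x xor f) ≡ (x xor p) xor f
  xor-rearrange x p f = trans (sym (xor-assoc p x f)) (cong (_xor f) (xor-comm p x))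

agree⇒plexCompare≡eq : ∀ N f {a b} → AgreeBelow N a b → plexCompare N f a b ≡ eq
agree⇒plexCompare≡eq zero    f ag = refl
agree⇒plexCompare≡eq (suc N) f {a} {b} ag rewrite sym (ag 0 z<s) =
  trans (plexStep-same N f (a 0) (a ∘ suc) (b ∘ suc)) (agree⇒plexCompare≡eq N _ (agreeBelow-suc ag))

plexCompare-refl : ∀ N f a → plexCompare N f a a ≡ eq
plexCompare-refl N f a = agree⇒plexCompare≡eq N f (λ _ _ → refl)

plexCompare≡eq⇒agree : ∀ N f a b → plexCompare N f a b ≡ eq → AgreeBelow N a b
plexCompare≡eq⇒agree (suc N) f a b same with a 0 ≟ᴸ b 0
... | no a0≢b0 = ⊥-elim (compareLetters-distinct f (a 0) (b 0) a0≢b0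
        (trans (sym (plexStep-distinct N f (a 0) (b 0) (a ∘ suc) (b ∘ suc) a0≢b0)) same))
... | yes a0≡b0 = agreeBelow-∷ a0≡b0 (plexCompare≡eq⇒agree N _ (a ∘ suc) (b ∘ suc) tails-same)
  where
  tails-same : plexCompare N (reverses (a 0) xor f) (a ∘ suc) (b ∘ suc) ≡ eq
  tails-same = trans (sym (plexStep-same N f (a 0) (a ∘ suc) (b ∘ suc)))
                     (trans (cong (λ y → plexStep N f (a 0) y (a ∘ suc) (b ∘ suc)) a0≡b0) same)

record FirstDifference (N : ℕ) (a b : Stream) : Set where
  constructor firstDifferenceAt
  field
    pos    : ℕ
    pos<N  : pos < N
    before : AgreeBelow pos a b
    differ : a pos ≢ b pos

firstDifference : ∀ N a b → ¬ AgreeBelow N a b → FirstDifference N a b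
firstDifference zero    a b ¬ag = ⊥-elim (¬ag λ _ ())
firstDifference (suc N) a b ¬ag with a 0 ≟ᴸ b 0
... | no a0≢b0  = firstDifferenceAt 0 z<s (λ _ ()) a0≢b0
... | yes a0≡b0 with firstDifference N (a ∘ suc) (b ∘ suc) (¬ag ∘ agreeBelow-∷ a0≡b0)
...   | firstDifferenceAt p p<N ag df = firstDifferenceAt (suc p) (s≤s p<N) (agreeBelow-∷ a0≡b0 ag) df

plexCompare≢eq⇒firstDifference : ∀ N f a b → plexCompare N f a b ≢ eq → FirstDifference N a b
plexCompare≢eq⇒firstDifference N f a b ≢eq = firstDifference N a b (≢eq ∘ agree⇒plexCompare≡eq N f)

plexCompare-extend : ∀ N M f a b → N ≤ M → plexCompare N f a b ≢ eq → plexCompare M f a b ≡ plexCompare N f a b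
plexCompare-extend N M f a b N≤M ≢eq with plexCompare≢eq⇒firstDifference N f a b ≢eq
... | firstDifferenceAt d d<N ag df =
  trans (plexCompare-firstDifference d M f a b (<-≤-trans d<N N≤M) ag df)
        (sym (plexCompare-firstDifference d N f a b d<N ag df))

plexStep-cong : ∀ N f x y {a a′ b b′} → (∀ g → plexCompare N g a b ≡ plexCompare N g a′ b′) →
  plexStep N f x y a b ≡ plexStep N f x y a′ b′
plexStep-cong N f x y {a} {a′} {b} {b′} tails with x ≟ᴸ y
... | yes refl = trans (plexStep-same N f x a b) (trans (tails _) (sym (plexStep-same N f x a′ b′)))
... | no x≢y  = trans (plexStep-distinct N f x y a b x≢y) (sym (plexStep-distinct N f x y a′ b′ x≢y))

plexCompare-cong : ∀ N f {a a′ b b′} → AgreeBelow N a a′ → AgreeBelow N b b′ →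
  plexCompare N f a b ≡ plexCompare N f a′ b′
plexCompare-cong zero    f ea eb = refl
plexCompare-cong (suc N) f {a} {a′} {b} {b′} ea eb rewrite ea 0 z<s | eb 0 z<s =
  plexStep-cong N f (a′ 0) (b′ 0) (λ g → plexCompare-cong N g (agreeBelow-suc ea) (agreeBelow-suc eb))

plexCompare-swap : ∀ N f a b → plexCompare N f a b ≡ invert (plexCompare N f b a)
plexCompare-swap zero    f a b = refl
plexCompare-swap (suc N) f a b with a 0 ≟ᴸ b 0
... | no a0≢b0 =
  trans (plexStep-distinct N f (a 0) (b 0) (a ∘ suc) (b ∘ suc) a0≢b0)
   (trans (compareLetters-swap f (a 0) (b 0))
          (cong invert (sym (plexStep-distinct N f (b 0) (a 0) (b ∘ suc) (a ∘ suc) (a0≢b0 ∘ sym)))))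
... | yes a0≡b0 rewrite a0≡b0 =
  trans (plexStep-same N f (b 0) (a ∘ suc) (b ∘ suc))
   (trans (plexCompare-swap N _ (a ∘ suc) (b ∘ suc))
          (cong invert (sym (plexStep-same N f (b 0) (b ∘ suc) (a ∘ suc)))))

plexCompare-not : ∀ N f a b → plexCompare N (not f) a b ≡ invert (plexCompare N f a b)
plexCompare-not zero    f a b = refl
plexCompare-not (suc N) f a b with a 0 ≟ᴸ b 0
... | no a0≢b0 =
  trans (plexStep-distinct N (not f) (a 0) (b 0) (a ∘ suc) (b ∘ suc) a0≢b0)
   (trans (compareLetters-not f (a 0) (b 0))
          (cong invert (sym (plexStep-distinct N f (a 0) (b 0) (a ∘ suc) (b ∘ suc) a0≢b0))))
... | yes a0≡b0 rewrite a0≡b0 =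
  trans (plexStep-same N (not f) (b 0) (a ∘ suc) (b ∘ suc))
   (trans (cong (λ g → plexCompare N g (a ∘ suc) (b ∘ suc)) (xor-not-comm (reverses (b 0)) f))
    (trans (plexCompare-not N _ (a ∘ suc) (b ∘ suc))
           (cong invert (sym (plexStep-same N f (b 0) (a ∘ suc) (b ∘ suc))))))
  where
  xor-not-comm : ∀ x f → x xor not f ≡ not (x xor f)
  xor-not-comm false f = refl
  xor-not-comm true  f = refl

ascending-antisym : ∀ f → ascending f ≡ lt → ascending (not f) ≡ lt → ⊥
ascending-antisym false _ ()
ascending-antisym true  ()

mutual
  plexStep-trans : ∀ N f x y z a b c → plexStep N f x y a b ≡ lt → plexStep N f y z b c ≡ lt →
    plexStep N f x z a c ≡ lt
  plexStep-trans N f L L L a b c h₁ h₂ = plexCompare-trans N (not f) a b c h₁ h₂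
  plexStep-trans N f L L ⋆ a b c h₁ h₂ = h₂
  plexStep-trans N f L L R a b c h₁ h₂ = h₂
  plexStep-trans N f L ⋆ L a b c h₁ h₂ = ⊥-elim (ascending-antisym f h₁ h₂)
  plexStep-trans N f L ⋆ ⋆ a b c h₁ h₂ = h₁
  plexStep-trans N f L ⋆ R a b c h₁ h₂ = h₁
  plexStep-trans N f L R L a b c h₁ h₂ = ⊥-elim (ascending-antisym f h₁ h₂)
  plexStep-trans N f L R ⋆ a b c h₁ h₂ = h₁
  plexStep-trans N f L R R a b c h₁ h₂ = h₁
  plexStep-trans N f ⋆ L L a b c h₁ h₂ = h₁
  plexStep-trans N f ⋆ L ⋆ a b c h₁ h₂ = ⊥-elim (ascending-antisym f h₂ h₁)
  plexStep-trans N f ⋆ L R a b c h₁ h₂ = h₂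
  plexStep-trans N f ⋆ ⋆ L a b c h₁ h₂ = h₂
  plexStep-trans N f ⋆ ⋆ ⋆ a b c h₁ h₂ = plexCompare-trans N f a b c h₁ h₂
  plexStep-trans N f ⋆ ⋆ R a b c h₁ h₂ = h₂
  plexStep-trans N f ⋆ R L a b c h₁ h₂ = h₂
  plexStep-trans N f ⋆ R ⋆ a b c h₁ h₂ = ⊥-elim (ascending-antisym f h₁ h₂)
  plexStep-trans N f ⋆ R R a b c h₁ h₂ = h₁
  plexStep-trans N f R L L a b c h₁ h₂ = h₁
  plexStep-trans N f R L ⋆ a b c h₁ h₂ = h₁
  plexStep-trans N f R L R a b c h₁ h₂ = ⊥-elim (ascending-antisym f h₂ h₁)
  plexStep-trans N f R ⋆ L a b c h₁ h₂ = h₁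
  plexStep-trans N f R ⋆ ⋆ a b c h₁ h₂ = h₁
  plexStep-trans N f R ⋆ R a b c h₁ h₂ = ⊥-elim (ascending-antisym f h₂ h₁)
  plexStep-trans N f R R L a b c h₁ h₂ = h₂
  plexStep-trans N f R R ⋆ a b c h₁ h₂ = h₂
  plexStep-trans N f R R R a b c h₁ h₂ = plexCompare-trans N f a b c h₁ h₂

  plexCompare-trans : ∀ N f a b c → plexCompare N f a b ≡ lt → plexCompare N f b c ≡ lt →
    plexCompare N f a c ≡ lt
  plexCompare-trans (suc N) f a b c =
    plexStep-trans N f (a 0) (b 0) (c 0) (a ∘ suc) (b ∘ suc) (c ∘ suc)

plexCompare-firstDifference-≈ : ∀ d N f {a a′ b b′} → d < N → AgreeBelow (suc d) a a′ → AgreeBelow (suc d) b b′ →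
  AgreeBelow d a′ b′ → a′ d ≢ b′ d → plexCompare N f a b ≡ compareLetters (lParity d a′ xor f) (a′ d) (b′ d)
plexCompare-firstDifference-≈ d N f {a} {a′} {b} {b′} d<N ea eb ag df =
  trans (plexCompare-firstDifference d N f a b d<N ag″ df″)
        (trans (cong (λ g → compareLetters (g xor f) (a d) (b d)) (lParity-cong d (agreeBelow-≤ (n≤1+n d) ea)))
               (cong₂ (compareLetters (lParity d a′ xor f)) (ea d ≤-refl) (eb d ≤-refl)))
  where
  ag″ : AgreeBelow d a b
  ag″ t t<d = trans (ea t (m≤n⇒m≤1+n t<d)) (trans (ag t t<d) (sym (eb t (m≤n⇒m≤1+n t<d))))
  df″ : a d ≢ b d
  df″ a≡b = df (trans (sym (ea d ≤-refl)) (trans a≡b (eb d ≤-refl)))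

data _<ᴸ_ : Letter → Letter → Set where
  L<⋆ : L <ᴸ ⋆
  L<R : L <ᴸ R
  ⋆<R : ⋆ <ᴸ R

Oriented : {A : Set} → (A → A → Set) → Bool → A → A → Set
Oriented _≺_ false x y = x ≺ y
Oriented _≺_ true  x y = y ≺ x

compareLetters≡lt : ∀ f x y → compareLetters f x y ≡ lt → Oriented _<ᴸ_ f x y
compareLetters≡lt false L ⋆ _ = L<⋆
compareLetters≡lt false L R _ = L<R
compareLetters≡lt false ⋆ R _ = ⋆<R
compareLetters≡lt true  ⋆ L _ = L<⋆
compareLetters≡lt true  R L _ = L<R
compareLetters≡lt true  R ⋆ _ = ⋆<R
compareLetters≡lt false L L ()
compareLetters≡lt false ⋆ L ()
compareLetters≡lt false ⋆ ⋆ ()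
compareLetters≡lt false R L ()
compareLetters≡lt false R ⋆ ()
compareLetters≡lt false R R ()
compareLetters≡lt true  L L ()
compareLetters≡lt true  L ⋆ ()
compareLetters≡lt true  L R ()
compareLetters≡lt true  ⋆ ⋆ ()
compareLetters≡lt true  ⋆ R ()
compareLetters≡lt true  R R ()

_≤ᴸ_ : Letter → Letter → Set
x ≤ᴸ y = x ≡ y ⊎ x <ᴸ y

≤L⇒L : ∀ {x} → x ≤ᴸ L → x ≡ L
≤L⇒L (inj₁ refl) = refl
≤L⇒L (inj₂ ())

≤⋆⇒L : ∀ {x} → x ≤ᴸ ⋆ → x ≢ ⋆ → x ≡ L
≤⋆⇒L (inj₁ refl) x≢⋆ = ⊥-elim (x≢⋆ refl)
≤⋆⇒L (inj₂ L<⋆)  _   = refl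

⋆≤⇒R : ∀ {y} → ⋆ ≤ᴸ y → y ≢ ⋆ → y ≡ R
⋆≤⇒R (inj₁ refl) y≢⋆ = ⊥-elim (y≢⋆ refl)
⋆≤⇒R (inj₂ ⋆<R)  _   = refl

R≤⇒R : ∀ {y} → R ≤ᴸ y → y ≡ R
R≤⇒R (inj₁ refl) = refl
R≤⇒R (inj₂ ())

plexCompare-lt⇒head : ∀ N a b → plexCompare (suc N) false a b ≡ lt → a 0 ≤ᴸ b 0
plexCompare-lt⇒head N a b a<b with a 0 ≟ᴸ b 0
... | yes same   = inj₁ same
... | no  differ = inj₂ (compareLetters≡lt false (a 0) (b 0)
                    (trans (sym (plexStep-distinct N false (a 0) (b 0) (a ∘ suc) (b ∘ suc) differ)) a<b))

plexCompare-tails-L : ∀ N a b → a 0 ≡ L → b 0 ≡ L → plexCompare (suc N) false a b ≡ lt →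
  plexCompare N false (b ∘ suc) (a ∘ suc) ≡ lt
plexCompare-tails-L N a b a0≡L b0≡L a<b = begin
  plexCompare N false (b ∘ suc) (a ∘ suc)            ≡⟨ plexCompare-swap N false (b ∘ suc) (a ∘ suc) ⟩
  invert (plexCompare N false (a ∘ suc) (b ∘ suc))   ≡⟨ sym (plexCompare-not N false (a ∘ suc) (b ∘ suc)) ⟩
  plexCompare N true (a ∘ suc) (b ∘ suc)
    ≡⟨ subst₂ (λ x y → plexStep N false x y (a ∘ suc) (b ∘ suc) ≡ lt) a0≡L b0≡L a<b ⟩
  lt ∎

plexCompare-tails-R : ∀ N a b → a 0 ≡ R → b 0 ≡ R → plexCompare (suc N) false a b ≡ lt →
  plexCompare N false (a ∘ suc) (b ∘ suc) ≡ lt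
plexCompare-tails-R N a b a0≡R b0≡R = subst₂ (λ x y → plexStep N false x y (a ∘ suc) (b ∘ suc) ≡ lt) a0≡R b0≡R

plexCompare-<-≤-trans : ∀ N a b c → plexCompare N false a b ≡ lt → plexCompare N false b c ≢ gt →
  plexCompare N false a c ≡ lt
plexCompare-<-≤-trans N a b c a<b b≤c = by-result _ refl
  where
  by-result : ∀ o → plexCompare N false b c ≡ o → plexCompare N false a c ≡ lt
  by-result lt b<c = plexCompare-trans N false a b c a<b b<c
  by-result eq b≡c =
    trans (plexCompare-cong N false (λ _ _ → refl) (λ t t<N → sym (plexCompare≡eq⇒agree N false b c b≡c t t<N))) a<b
  by-result gt b>c = ⊥-elim (b≤c b>c)

neither-lt-nor-gt : ∀ o → o ≢ lt → o ≢ gt → o ≡ eq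
neither-lt-nor-gt lt ≢lt _   = ⊥-elim (≢lt refl)
neither-lt-nor-gt eq _   _   = refl
neither-lt-nor-gt gt _   ≢gt = ⊥-elim (≢gt refl)


-- Starred words

-- A digit 1 of A(σ) records a point left of m.
letter : Bool → Letter
letter true  = L
letter false = R

letter≢⋆ : ∀ b → letter b ≢ ⋆
letter≢⋆ true  ()
letter≢⋆ false ()

reverses-letter : ∀ b → reverses (letter b) ≡ b
reverses-letter true  = refl
reverses-letter false = refl

letter-injective : ∀ {b c} → letter b ≡ letter c → b ≡ c
letter-injective {true}  {true}  _ = refl
letter-injective {false} {false} _ = refl
letter-injective {true}  {false} ()
letter-injective {false} {true}  ()

letter<⋆⇒xor : ∀ f b → compareLetters f (letter b) ⋆ ≡ lt → f xor b ≡ true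
letter<⋆⇒xor false true  _ = refl
letter<⋆⇒xor true  false _ = refl
letter<⋆⇒xor false false ()
letter<⋆⇒xor true  true  ()

xor⇒letter<⋆ : ∀ f b → f xor b ≡ true → compareLetters f (letter b) ⋆ ≡ lt
xor⇒letter<⋆ false true  _ = refl
xor⇒letter<⋆ true  false _ = refl
xor⇒letter<⋆ false false ()
xor⇒letter<⋆ true  true  ()

letter<letter⇒xor : ∀ f b c → letter b ≢ letter c → compareLetters f (letter b) (letter c) ≡ lt → f xor b ≡ true
letter<letter⇒xor f     true  true  b≢c _ = ⊥-elim (b≢c refl)
letter<letter⇒xor f     false false b≢c _ = ⊥-elim (b≢c refl)
letter<letter⇒xor false true  false _   _ = refl
letter<letter⇒xor true  false true  _   _ = refl
letter<letter⇒xor true  true  false _   ()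
letter<letter⇒xor false false true  _   ()

xor⇒letter<letter : ∀ f b c → letter b ≢ letter c → f xor b ≡ true → compareLetters f (letter b) (letter c) ≡ lt
xor⇒letter<letter f     true  true  b≢c _ = ⊥-elim (b≢c refl)
xor⇒letter<letter f     false false b≢c _ = ⊥-elim (b≢c refl)
xor⇒letter<letter false true  false _   _ = refl
xor⇒letter<letter true  false true  _   _ = refl
xor⇒letter<letter true  true  false _   ()
xor⇒letter<letter false false true  _   ()

StarMinimal : ℕ → Stream → Set
StarMinimal n w = ∀ j → 0 < j → j < n → plexCompare n false w (shift j w) ≡ lt

ShiftMinimal : ℕ → Stream → Set
ShiftMinimal n U = ∀ j → j < n → plexCompare n false U (shift j U) ≢ gt

-- A 0/1-sequence u of period k+1 and the stream w agreeing with it below k and with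
-- w k = ⋆; for σ ∈ CUP(k+1), u is A(σ) read cyclically and w the itinerary of σ(m).
-- w is strictly below its proper shifts exactly when U is weakly below its shifts
-- and every proper period j of u leaves an odd-parity prefix of length k+1-j.
module StarredWord (k : ℕ) (u : ℕ → Bool) (w : Stream)
  (u-periodic : Periodic (suc k) u) (w≈U : AgreeBelow k w (letter ∘ u)) (w-⋆ : w k ≡ ⋆) where

  U : Stream
  U = letter ∘ u

  OddPeriods : Set
  OddPeriods = ∀ j → 0 < j → j < suc k → Periodic j u → lParity (suc k ∸ j) U ≡ true

  lParity-U-suc : ∀ e → lParity (suc e) U ≡ lParity e U xor u e
  lParity-U-suc e = trans (lParity-suc e U) (cong (lParity e U xor_) (reverses-letter (u e)))

  -- Comparing w with its shift by j, where the ⋆ of the shift sits at position e = k - j.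
  module Shift (j : ℕ) (0<j : 0 < j) (j<n : j < suc k) where

    e : ℕ
    e = k ∸ j

    j+e≡k : j + e ≡ k
    j+e≡k = m+[n∸m]≡n (s≤s⁻¹ j<n)

    e<k : e < k
    e<k = subst (e <_) j+e≡k (+-monoˡ-≤ e 0<j)

    n∸j≡1+e : suc k ∸ j ≡ suc e
    n∸j≡1+e = +-∸-assoc 1 (s≤s⁻¹ j<n)

    U-wrap : ∀ t → U (j + (suc e + t)) ≡ U t
    U-wrap t = cong letter (trans (cong u j+[1+e+t]≡n+t) (u-periodic t))
      where
      j+[1+e+t]≡n+t : j + (suc e + t) ≡ suc k + t
      j+[1+e+t]≡n+t = trans (sym (+-assoc j (suc e) t)) (cong (_+ t) (trans (+-suc j e) (cong suc j+e≡k)))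

    compare-before-⋆ : ∀ d → d < e → AgreeBelow d U (shift j U) → U d ≢ U (j + d) →
      plexCompare (suc k) false w (shift j w) ≡ compareLetters (lParity d U) (U d) (U (j + d))
    compare-before-⋆ d d<e ag df =
      trans (plexCompare-firstDifference-≈ d (suc k) false (<-trans d<e (m≤n⇒m≤1+n e<k)) w≈U-left w≈U-right ag df)
            (cong (λ g → compareLetters g (U d) (U (j + d))) (xor-identityʳ _))
      where
      w≈U-left : AgreeBelow (suc d) w U
      w≈U-left t t≤d = w≈U t (<-≤-trans t≤d (<-trans d<e e<k))
      w≈U-right : AgreeBelow (suc d) (shift j w) (shift j U)
      w≈U-right t t≤d = w≈U (j + t) (subst (j + t <_) j+e≡k (+-monoʳ-< j (<-≤-trans t≤d d<e)))

    compare-at-⋆ : AgreeBelow e U (shift j U) →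
      plexCompare (suc k) false w (shift j w) ≡ compareLetters (lParity e U) (U e) ⋆
    compare-at-⋆ ag =
      trans (plexCompare-firstDifference-≈ e (suc k) false (m≤n⇒m≤1+n e<k) w≈U-left (λ _ _ → refl) ag′ U≢⋆)
            (cong₂ (λ g → compareLetters g (U e)) (xor-identityʳ _) w[j+e]≡⋆)
      where
      w[j+e]≡⋆ : w (j + e) ≡ ⋆
      w[j+e]≡⋆ = trans (cong w j+e≡k) w-⋆
      w≈U-left : AgreeBelow (suc e) w U
      w≈U-left t t≤e = w≈U t (<-≤-trans t≤e e<k)
      ag′ : AgreeBelow e U (shift j w)
      ag′ t t<e = trans (ag t t<e) (sym (w≈U (j + t) (subst (j + t <_) j+e≡k (+-monoʳ-< j t<e))))
      U≢⋆ : U e ≢ w (j + e)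
      U≢⋆ Ue≡ = letter≢⋆ (u e) (trans Ue≡ w[j+e]≡⋆)

    agree-beyond-⋆ : ∀ d′ → AgreeBelow (suc e + d′) U (shift j U) → AgreeBelow d′ U (shift (suc e) U)
    agree-beyond-⋆ d′ ag t t<d′ = sym (trans (ag (suc e + t) (+-monoʳ-< (suc e) t<d′)) (U-wrap t))

    lParity-beyond-⋆ : ∀ d′ → AgreeBelow (suc e + d′) U (shift j U) →
      lParity (suc e + d′) U ≡ lParity (suc e) U xor lParity d′ U
    lParity-beyond-⋆ d′ ag =
      trans (lParity-+ (suc e) d′ U) (cong (lParity (suc e) U xor_) (sym (lParity-cong d′ (agree-beyond-⋆ d′ ag))))

    ⋆-xor : StarMinimal (suc k) w → AgreeBelow e U (shift j U) → lParity e U xor u e ≡ true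
    ⋆-xor sm ag = letter<⋆⇒xor _ (u e) (trans (sym (compare-at-⋆ ag)) (sm j 0<j j<n))

    ⋆-odd : StarMinimal (suc k) w → AgreeBelow e U (shift j U) → lParity (suc e) U ≡ true
    ⋆-odd sm ag = trans (lParity-U-suc e) (⋆-xor sm ag)

  starMinimal⇒oddPeriods : StarMinimal (suc k) w → OddPeriods
  starMinimal⇒oddPeriods sm j 0<j j<n j-periodic =
    trans (cong (λ x → lParity x U) n∸j≡1+e) (⋆-odd sm (λ t _ → cong letter (sym (j-periodic t))))
    where open Shift j 0<j j<n

  module _ (sm : StarMinimal (suc k) w) where

    FirstDifferenceAscends : ℕ → Set
    FirstDifferenceAscends d = ∀ j → 0 < j → j < suc k → AgreeBelow d U (shift j U) → U d ≢ U (j + d) →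
      compareLetters (lParity d U) (U d) (U (j + d)) ≡ lt

    -- By strong induction on d: a first difference beyond the ⋆ of the shift by j
    -- is a first difference, d - (k - j) - 1 positions earlier, of U and its shift by k - j + 1.
    firstDifferenceAscends : ∀ d → FirstDifferenceAscends d
    firstDifferenceAscends = <-rec FirstDifferenceAscends step
      where
      step : ∀ d → (∀ {d′} → d′ < d → FirstDifferenceAscends d′) → FirstDifferenceAscends d
      step d IH j 0<j j<n = ascends d IH (<-cmp d e)
        where
        open Shift j 0<j j<n
        ascends : ∀ d → (∀ {d′} → d′ < d → FirstDifferenceAscends d′) → Tri (d < e) (d ≡ e) (e < d) →
          AgreeBelow d U (shift j U) → U d ≢ U (j + d) → compareLetters (lParity d U) (U d) (U (j + d)) ≡ lt
        ascends d IH (tri< d<e _ _) ag df = trans (sym (compare-before-⋆ d d<e ag df)) (sm j 0<j j<n)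
        ascends d IH (tri≈ _ refl _) ag df = xor⇒letter<letter _ (u e) (u (j + e)) df (⋆-xor sm ag)
        ascends d IH (tri> _ _ e<d) ag df with m≤n⇒∃[o]m+o≡n e<d
        ... | d′ , refl = begin
          compareLetters (lParity (suc e + d′) U) (U (suc e + d′)) (U (j + (suc e + d′)))
            ≡⟨ cong₂ (λ g → compareLetters g (U (suc e + d′))) lParity≡not (U-wrap d′) ⟩
          compareLetters (not (lParity d′ U)) (U (suc e + d′)) (U d′)
            ≡⟨ compareLetters-not-swap (lParity d′ U) (U (suc e + d′)) (U d′) ⟩
          compareLetters (lParity d′ U) (U d′) (U (suc e + d′))
            ≡⟨ IH (s≤s (m≤n+m d′ e)) (suc e) z<s (s≤s e<k) (agree-beyond-⋆ d′ ag) (df ∘ shifted) ⟩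
          lt ∎
          where
          lParity≡not : lParity (suc e + d′) U ≡ not (lParity d′ U)
          lParity≡not = trans (lParity-beyond-⋆ d′ ag)
            (cong (_xor lParity d′ U) (⋆-odd sm (agreeBelow-≤ (m≤n⇒m≤1+n (m≤m+n e d′)) ag)))
          shifted : U d′ ≡ U (suc e + d′) → U (suc e + d′) ≡ U (j + (suc e + d′))
          shifted same = sym (trans (U-wrap d′) same)

    starMinimal⇒shiftMinimal : ShiftMinimal (suc k) U
    starMinimal⇒shiftMinimal zero _ U>U with trans (sym U>U) (plexCompare-refl (suc k) false U)
    ... | ()
    starMinimal⇒shiftMinimal (suc j) j<n U>shift
      with plexCompare≢eq⇒firstDifference (suc k) false U (shift (suc j) U) (λ U≡ → gt≢eq (trans (sym U>shift) U≡))
    ... | firstDifferenceAt d d<n ag df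
      with trans (sym U>shift) (trans (plexCompare-firstDifference d (suc k) false U (shift (suc j) U) d<n ag df)
             (trans (cong (λ g → compareLetters g (U d) (U (suc j + d))) (xor-identityʳ _))
                    (firstDifferenceAscends d (suc j) z<s j<n ag df)))
    ... | ()

  module _ (minimal : ShiftMinimal (suc k) U) (odd : OddPeriods) where

    shiftMinimal⇒starMinimal : StarMinimal (suc k) w
    shiftMinimal⇒starMinimal j 0<j j<n = by-comparison (plexCompare (suc k) false U (shift j U)) refl
      where
      open Shift j 0<j j<n

      ⋆-odd-beyond : ∀ d′ → suc e + d′ < suc k → AgreeBelow (suc e + d′) U (shift j U) →
        U (suc e + d′) ≢ U (j + (suc e + d′)) →
        compareLetters (lParity (suc e + d′) U) (U (suc e + d′)) (U (j + (suc e + d′))) ≡ lt →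
        ∀ b → lParity (suc e) U ≡ b → b ≡ true
      ⋆-odd-beyond d′ d<n ag df V true  _    = refl
      ⋆-odd-beyond d′ d<n ag df V false even = ⊥-elim (minimal (suc e) (s≤s e<k) U>shift)
        where
        df′ : U d′ ≢ U (suc e + d′)
        df′ same = df (sym (trans (U-wrap d′) same))
        V′ : compareLetters (lParity d′ U) (U (suc e + d′)) (U d′) ≡ lt
        V′ = trans (sym (cong₂ (λ g → compareLetters g (U (suc e + d′)))
                                (trans (lParity-beyond-⋆ d′ ag) (cong (_xor lParity d′ U) even)) (U-wrap d′))) V
        U>shift : plexCompare (suc k) false U (shift (suc e) U) ≡ gt
        U>shift = begin
          plexCompare (suc k) false U (shift (suc e) U)
            ≡⟨ plexCompare-firstDifference d′ (suc k) false U (shift (suc e) U) d′<n (agree-beyond-⋆ d′ ag) df′ ⟩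
          compareLetters (lParity d′ U xor false) (U d′) (U (suc e + d′))
            ≡⟨ cong (λ g → compareLetters g (U d′) (U (suc e + d′))) (xor-identityʳ _) ⟩
          compareLetters (lParity d′ U) (U d′) (U (suc e + d′))
            ≡⟨ compareLetters-swap (lParity d′ U) (U d′) (U (suc e + d′)) ⟩
          invert (compareLetters (lParity d′ U) (U (suc e + d′)) (U d′))
            ≡⟨ cong invert V′ ⟩
          gt ∎
          where
          d′<n : d′ < suc k
          d′<n = ≤-<-trans (m≤n+m d′ (suc e)) d<n

      at-firstDifference : ∀ d → Tri (d < e) (d ≡ e) (e < d) → d < suc k →
        AgreeBelow d U (shift j U) → U d ≢ U (j + d) →
        compareLetters (lParity d U) (U d) (U (j + d)) ≡ lt → plexCompare (suc k) false w (shift j w) ≡ lt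
      at-firstDifference d (tri< d<e _ _) _ ag df V = trans (compare-before-⋆ d d<e ag df) V
      at-firstDifference d (tri≈ _ refl _) _ ag df V =
        trans (compare-at-⋆ ag) (xor⇒letter<⋆ _ (u e) (letter<letter⇒xor _ (u e) (u (j + e)) df V))
      at-firstDifference d (tri> _ _ e<d) d<n ag df V with m≤n⇒∃[o]m+o≡n e<d
      ... | d′ , refl = trans (compare-at-⋆ ag-e)
              (xor⇒letter<⋆ _ (u e) (trans (sym (lParity-U-suc e)) (⋆-odd-beyond d′ d<n ag df V _ refl)))
        where
        ag-e : AgreeBelow e U (shift j U)
        ag-e = agreeBelow-≤ (m≤n⇒m≤1+n (m≤m+n e d′)) ag

      by-comparison : ∀ o → plexCompare (suc k) false U (shift j U) ≡ o → plexCompare (suc k) false w (shift j w) ≡ lt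
      by-comparison gt U>shift = ⊥-elim (minimal j j<n U>shift)
      by-comparison eq U≡shift =
        trans (compare-at-⋆ (agreeBelow-≤ (m≤n⇒m≤1+n (<⇒≤ e<k)) agree))
              (xor⇒letter<⋆ _ (u e) (trans (sym (lParity-U-suc e))
                 (trans (cong (λ x → lParity x U) (sym n∸j≡1+e)) (odd j 0<j j<n j-periodic))))
        where
        agree : AgreeBelow (suc k) U (shift j U)
        agree = plexCompare≡eq⇒agree (suc k) false U (shift j U) U≡shift
        j-periodic : Periodic j u
        j-periodic = periodic-ext (periodic-shift u-periodic j) u-periodic (λ t t<n → letter-injective (sym (agree t t<n)))
      by-comparison lt U<shift with plexCompare≢eq⇒firstDifference (suc k) false U (shift j U) (lt≢eq ∘ trans (sym U<shift))
      ... | firstDifferenceAt d d<n ag df =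
        at-firstDifference d (<-cmp d e) d<n ag df
          (trans (sym (cong (λ g → compareLetters g (U d) (U (j + d))) (xor-identityʳ _)))
                 (trans (sym (plexCompare-firstDifference d (suc k) false U (shift j U) d<n ag df)) U<shift))


-- Binary words, rotations and necklaces

rot-+ : ∀ a b s → rot (a + b) s ≡ rot b (rot a s)
rot-+ zero    b s = refl
rot-+ (suc a) b s = rot-+ a b (rot1 s)

rot-comm : ∀ a b s → rot a (rot b s) ≡ rot b (rot a s)
rot-comm a b s = trans (sym (rot-+ b a s)) (trans (cong (λ r → rot r s) (+-comm b a)) (rot-+ a b s))

rot-++ : ∀ (a b : List Bool) → rot (length a) (a ++ b) ≡ b ++ a
rot-++ []      b = sym (++-identityʳ b)
rot-++ (x ∷ a) b = trans (cong (rot (length a)) (++-assoc a b [ x ]))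
  (trans (rot-++ a (b ++ [ x ])) (++-assoc b [ x ] a))

rot-length : ∀ s → rot (length s) s ≡ s
rot-length s = trans (cong (rot (length s)) (sym (++-identityʳ s))) (rot-++ s [])

rot-periodic : ∀ s → Periodic (length s) (λ r → rot r s)
rot-periodic s r = trans (rot-+ (length s) r s) (cong (rot r) (rot-length s))

length-rot1 : ∀ s → length (rot1 s) ≡ length s
length-rot1 []      = refl
length-rot1 (x ∷ s) = trans (length-++ s) (+-comm (length s) 1)

length-rot : ∀ r s → length (rot r s) ≡ length s
length-rot zero    s = refl
length-rot (suc r) s = trans (length-rot r (rot1 s)) (length-rot1 s)

rot1-injective : ∀ {x y : List Bool} → rot1 x ≡ rot1 y → x ≡ y
rot1-injective {[]}    {[]}    _ = refl
rot1-injective {a ∷ x} {b ∷ y} same with ∷ʳ-injective x y same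
... | refl , refl = refl
rot1-injective {[]}    {b ∷ y} same with trans (cong length same) (length-rot1 (b ∷ y))
... | ()
rot1-injective {a ∷ x} {[]}    same with trans (sym (cong length same)) (length-rot1 (a ∷ x))
... | ()

rot-injective : ∀ r {x y : List Bool} → rot r x ≡ rot r y → x ≡ y
rot-injective zero    same = same
rot-injective (suc r) same = rot1-injective (rot-injective r same)

length-take-≤ : ∀ r (s : List Bool) → r ≤ length s → length (take r s) ≡ r
length-take-≤ r s r≤ = trans (length-take r s) (m≤n⇒m⊓n≡m r≤)

take-length-++ : ∀ (a b : List Bool) → take (length a) (a ++ b) ≡ a
take-length-++ []      b = refl
take-length-++ (x ∷ a) b = cong (x ∷_) (take-length-++ a b)

drop-length-++ : ∀ (a b : List Bool) → drop (length a) (a ++ b) ≡ b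
drop-length-++ []      b = refl
drop-length-++ (x ∷ a) b = drop-length-++ a b

take-++-≤ : ∀ r (a b : List Bool) → r ≤ length a → take r (a ++ b) ≡ take r a
take-++-≤ zero    a       b _         = refl
take-++-≤ (suc r) (x ∷ a) b (s≤s r≤) = cong (x ∷_) (take-++-≤ r a b r≤)

drop-++-≤ : ∀ r (a b : List Bool) → r ≤ length a → drop r (a ++ b) ≡ drop r a ++ b
drop-++-≤ zero    a       b _         = refl
drop-++-≤ (suc r) (x ∷ a) b (s≤s r≤) = drop-++-≤ r a b r≤

take-+ : ∀ a b (s : List Bool) → take (a + b) s ≡ take a s ++ take b (drop a s)
take-+ zero    b s       = refl
take-+ (suc a) b []      = sym (take-[] b)
take-+ (suc a) b (x ∷ s) = cong (x ∷_) (take-+ a b s)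

rot-drop-take : ∀ r s → r ≤ length s → rot r s ≡ drop r s ++ take r s
rot-drop-take r s r≤ = trans (cong (rot r) (sym (take++drop≡id r s)))
  (trans (cong (λ q → rot q (take r s ++ drop r s)) (sym (length-take-≤ r s r≤))) (rot-++ (take r s) (drop r s)))

rot-doubled : ∀ e z → e ≤ length z → rot e (z ++ z) ≡ rot e z ++ rot e z
rot-doubled e z e≤ = begin
  rot e (z ++ z)
    ≡⟨ rot-drop-take e (z ++ z) (subst (e ≤_) (sym (length-++ z)) (≤-trans e≤ (m≤m+n _ _))) ⟩
  drop e (z ++ z) ++ take e (z ++ z)        ≡⟨ cong₂ _++_ (drop-++-≤ e z z e≤) (take-++-≤ e z z e≤) ⟩
  (drop e z ++ z) ++ take e z               ≡⟨ cong (λ q → (drop e z ++ q) ++ take e z) (sym (take++drop≡id e z)) ⟩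
  (drop e z ++ take e z ++ drop e z) ++ take e z ≡⟨ ++-assoc (drop e z) (take e z ++ drop e z) (take e z) ⟩
  drop e z ++ (take e z ++ drop e z) ++ take e z ≡⟨ cong (drop e z ++_) (++-assoc (take e z) (drop e z) (take e z)) ⟩
  drop e z ++ take e z ++ drop e z ++ take e z   ≡⟨ sym (++-assoc (drop e z) (take e z) _) ⟩
  (drop e z ++ take e z) ++ drop e z ++ take e z ≡⟨ cong₂ _++_ (sym (rot-drop-take e z e≤)) (sym (rot-drop-take e z e≤)) ⟩
  rot e z ++ rot e z ∎

rot-doubled-fixed : ∀ e z → e ≤ length z → rot e (z ++ z) ≡ z ++ z → rot e z ≡ z
rot-doubled-fixed e z e≤ fixed = begin
  rot e z                                       ≡⟨ sym (take-length-++ (rot e z) (rot e z)) ⟩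
  take (length (rot e z)) (rot e z ++ rot e z)  ≡⟨ cong₂ take (length-rot e z) (sym (rot-doubled e z e≤)) ⟩
  take (length z) (rot e (z ++ z))              ≡⟨ cong (take (length z)) fixed ⟩
  take (length z) (z ++ z)                      ≡⟨ take-length-++ z z ⟩
  z ∎

-- Junk value: the head of the empty word is taken to be 0.
hd : List Bool → Bool
hd []      = false
hd (x ∷ _) = x

nth : ℕ → List Bool → Bool
nth t u = hd (drop t u)

cyclic : List Bool → ℕ → Bool
cyclic u t = hd (rot t u)

cyclic-rot : ∀ r u t → cyclic (rot r u) t ≡ cyclic u (r + t)
cyclic-rot r u t = cong hd (sym (rot-+ r t u))

cyclic-periodic : ∀ u → Periodic (length u) (cyclic u)
cyclic-periodic u t = cong hd (rot-periodic u t)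

cyclic≡nth : ∀ u t → t < length u → cyclic u t ≡ nth t u
cyclic≡nth u t t<l = trans (cong hd (rot-drop-take t u (<⇒≤ t<l)))
  (hd-++ (drop t u) (take t u) (subst (0 <_) (sym (length-drop t u)) (m<n⇒0<n∸m t<l)))
  where
  hd-++ : ∀ (a b : List Bool) → 0 < length a → hd (a ++ b) ≡ hd a
  hd-++ (x ∷ a) b _ = refl

nth-ext : ∀ (u v : List Bool) → length u ≡ length v → AgreeBelow (length u) (λ t → nth t u) (λ t → nth t v) → u ≡ v
nth-ext []      []      _  _  = refl
nth-ext (x ∷ u) (y ∷ v) lu ag = cong₂ _∷_ (ag 0 z<s) (nth-ext u v (suc-injective lu) (agreeBelow-suc ag))

cyclic-ext : ∀ (u v : List Bool) → length u ≡ length v → AgreeBelow (length u) (cyclic u) (cyclic v) → u ≡ v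
cyclic-ext u v lu ag = nth-ext u v lu λ t t<l →
  trans (sym (cyclic≡nth u t t<l)) (trans (ag t t<l) (cyclic≡nth v t (subst (t <_) lu t<l)))

nth-++ : ∀ t (a b : List Bool) → t < length a → nth t (a ++ b) ≡ nth t a
nth-++ zero    (x ∷ a) b _         = refl
nth-++ (suc t) (x ∷ a) b (s≤s t<) = nth-++ t a b t<

nth-take : ∀ t r (s : List Bool) → t < r → nth t (take r s) ≡ nth t s
nth-take zero    (suc r) []      _         = refl
nth-take zero    (suc r) (x ∷ s) _         = refl
nth-take (suc t) (suc r) []      _         = refl
nth-take (suc t) (suc r) (x ∷ s) (s≤s t<r) = nth-take t r s t<r

parity-++ : ∀ a b → parity (a ++ b) ≡ parity a xor parity b
parity-++ []      b = refl
parity-++ (x ∷ a) b = trans (cong (x xor_) (parity-++ a b)) (sym (xor-assoc x (parity a) (parity b)))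

parity-doubled : ∀ z → parity (z ++ z) ≡ false
parity-doubled z = trans (parity-++ z z) (xor-same (parity z))

parity-rot1 : ∀ s → parity (rot1 s) ≡ parity s
parity-rot1 []      = refl
parity-rot1 (x ∷ s) = trans (parity-++ s [ x ]) (trans (cong (parity s xor_) (xor-identityʳ x)) (xor-comm (parity s) x))

parity-rot : ∀ r s → parity (rot r s) ≡ parity s
parity-rot zero    s = refl
parity-rot (suc r) s = trans (parity-rot r (rot1 s)) (parity-rot1 s)

lParity-nth : ∀ d u → lParity d (λ t → letter (nth t u)) ≡ parity (take d u)
lParity-nth zero    u       = refl
lParity-nth (suc d) []      = all-R d
  where
  all-R : ∀ d → lParity d (λ _ → R) ≡ false
  all-R zero    = refl
  all-R (suc d) = all-R d
lParity-nth (suc d) (x ∷ u) = cong₂ _xor_ (reverses-letter x) (lParity-nth d u)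

lParity-cyclic : ∀ d u → d ≤ length u → lParity d (letter ∘ cyclic u) ≡ parity (take d u)
lParity-cyclic d u d≤ =
  trans (lParity-cong d (λ t t<d → cong letter (cyclic≡nth u t (<-≤-trans t<d d≤)))) (lParity-nth d u)

2∣2+ : ∀ {m} → 2 ∣ m → 2 ∣ suc (suc m)
2∣2+ = ∣m∣n⇒∣m+n (n∣n {2})

2∣2+⁻¹ : ∀ {m} → 2 ∣ suc (suc m) → 2 ∣ m
2∣2+⁻¹ 2∣2+m = ∣m+n∣m⇒∣n 2∣2+m (n∣n {2})

mutual
  parity≡false⇒EvenOnes : ∀ s → parity s ≡ false → EvenOnes s
  parity≡false⇒EvenOnes []           _ = divides 0 refl
  parity≡false⇒EvenOnes (false ∷ s) p = parity≡false⇒EvenOnes s p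
  parity≡false⇒EvenOnes (true ∷ s)  p = parity≡true⇒OddOnes s (not-injective p)

  parity≡true⇒OddOnes : ∀ s → parity s ≡ true → OddOnes s
  parity≡true⇒OddOnes (false ∷ s) p = parity≡true⇒OddOnes s p
  parity≡true⇒OddOnes (true ∷ s)  p = 2∣2+ (parity≡false⇒EvenOnes s (not-injective p))

mutual
  EvenOnes⇒parity≡false : ∀ s → EvenOnes s → parity s ≡ false
  EvenOnes⇒parity≡false []          _ = refl
  EvenOnes⇒parity≡false (false ∷ s) e = EvenOnes⇒parity≡false s e
  EvenOnes⇒parity≡false (true ∷ s)  e = cong not (OddOnes⇒parity≡true s e)

  OddOnes⇒parity≡true : ∀ s → OddOnes s → parity s ≡ true
  OddOnes⇒parity≡true []          o = ⊥-elim (2≢1 (∣1⇒≡1 o))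
    where
    2≢1 : 2 ≢ 1
    2≢1 ()
  OddOnes⇒parity≡true (false ∷ s) o = OddOnes⇒parity≡true s o
  OddOnes⇒parity≡true (true ∷ s)  o = cong not (EvenOnes⇒parity≡false s (2∣2+⁻¹ o))

nth-applyUpTo : ∀ (f : ℕ → Bool) K t → t < K → nth t (applyUpTo f K) ≡ f t
nth-applyUpTo f (suc K) zero    _         = refl
nth-applyUpTo f (suc K) (suc t) (s≤s t<K) = nth-applyUpTo (f ∘ suc) K t t<K

parity-completed : ∀ s → parity (s ++ [ parity s ]) ≡ false
parity-completed s = trans (parity-++ s [ parity s ]) (trans (cong (parity s xor_) (xor-identityʳ (parity s))) (xor-same (parity s)))

record Least (P : ℕ → Set) (N : ℕ) : Set where
  constructor leastAt
  field
    value   : ℕ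
    value<N : value < N
    holds   : P value
    minimal : ∀ r → r < value → ¬ P r

searchLeast : (P : ℕ → Set) → (∀ r → Dec (P r)) → ∀ N → Least P N ⊎ (∀ r → r < N → ¬ P r)
searchLeast P P? zero = inj₂ λ _ ()
searchLeast P P? (suc N) with searchLeast P P? N
... | inj₁ (leastAt r r<N Pr min) = inj₁ (leastAt r (m≤n⇒m≤1+n r<N) Pr min)
... | inj₂ none with P? N
...   | yes PN = inj₁ (leastAt N ≤-refl PN none)
...   | no ¬PN = inj₂ λ r r≤N → [ none r , (λ { refl → ¬PN }) ]′ (m≤n⇒m<n∨m≡n (s≤s⁻¹ r≤N))

OddComplements : ℕ → List Bool → Set
OddComplements n u = ∀ j → 0 < j → j < n → rot j u ≡ u → parity (take (n ∸ j) u) ≡ true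

-- The shortest period p of an even word with odd complements: 2p < n would make the
-- prefix of length 2p both odd and even, and n < 2p would give the shorter period 2p - n.
module EvenWord (n : ℕ) (u : List Bool) (length-u : length u ≡ n) (even : parity u ≡ false)
  (odd-complements : OddComplements n u) where

  Period : ℕ → Set
  Period r = 0 < r × rot r u ≡ u

  period? : ∀ r → Dec (Period r)
  period? r with 0 <? r | ≡-dec Data.Bool._≟_ (rot r u) u
  ... | yes 0<r | yes fixed = yes (0<r , fixed)
  ... | no  0≮r | _         = no (0≮r ∘ proj₁)
  ... | _       | no  moved = no (moved ∘ proj₂)

  period-+ : ∀ p q → Period p → Period q → Period (p + q)
  period-+ p q (0<p , fixed-p) (_ , fixed-q) =
    <-≤-trans 0<p (m≤m+n p q) , trans (rot-+ p q u) (trans (cong (rot q) fixed-p) fixed-q)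

  take-period : ∀ r → r ≤ n → rot r u ≡ u → drop r u ++ take r u ≡ u
  take-period r r≤n fixed = trans (sym (rot-drop-take r u (subst (r ≤_) (sym length-u) r≤n))) fixed

  period-odd : ∀ r → 0 < r → r < n → rot r u ≡ u → parity (take r u) ≡ true
  period-odd r 0<r r<n fixed = trans (cong parity (sym drop≡take)) (not-injective (begin
    not (parity (drop (n ∸ r) u))
      ≡⟨ cong (_xor parity (drop (n ∸ r) u)) (sym (odd-complements r 0<r r<n fixed)) ⟩
    parity (take (n ∸ r) u) xor parity (drop (n ∸ r) u)    ≡⟨ sym (parity-++ (take (n ∸ r) u) (drop (n ∸ r) u)) ⟩
    parity (take (n ∸ r) u ++ drop (n ∸ r) u)              ≡⟨ cong parity (take++drop≡id (n ∸ r) u) ⟩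
    parity u                                               ≡⟨ even ⟩
    false ∎))
    where
    drop≡take : drop (n ∸ r) u ≡ take r u
    drop≡take = begin
      drop (n ∸ r) u                           ≡⟨ cong (drop (n ∸ r)) (sym (take-period r (<⇒≤ r<n) fixed)) ⟩
      drop (n ∸ r) (drop r u ++ take r u)
        ≡⟨ cong (λ m → drop m (drop r u ++ take r u)) (sym (trans (length-drop r u) (cong (_∸ r) length-u))) ⟩
      drop (length (drop r u)) (drop r u ++ take r u) ≡⟨ drop-length-++ (drop r u) (take r u) ⟩
      take r u ∎

  rot-n : rot n u ≡ u
  rot-n = subst (λ m → rot m u ≡ u) length-u (rot-length u)

  module ShortestPeriod (p : ℕ) (p<n : p < n) (period : Period p) (shortest : ∀ r → r < p → ¬ Period r) where

    p≤length : p ≤ length u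
    p≤length = subst (p ≤_) (sym length-u) (<⇒≤ p<n)

    not-below-half : p + p < n → ⊥
    not-below-half pp<n = true≢false (trans (sym (period-odd (p + p) 0<pp pp<n fixed-pp)) even-pp)
      where
      true≢false : true ≢ false
      true≢false ()
      0<pp : 0 < p + p
      0<pp = proj₁ (period-+ p p period period)
      fixed-pp : rot (p + p) u ≡ u
      fixed-pp = proj₂ (period-+ p p period period)
      p≤length-drop : p ≤ length (drop p u)
      p≤length-drop = subst (p ≤_) (sym (trans (length-drop p u) (cong (_∸ p) length-u)))
                            (subst (_≤ n ∸ p) (m+n∸m≡n p p) (∸-monoˡ-≤ p (<⇒≤ pp<n)))
      even-pp : parity (take (p + p) u) ≡ false
      even-pp = begin
        parity (take (p + p) u)                   ≡⟨ cong parity (take-+ p p u) ⟩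
        parity (take p u ++ take p (drop p u))
          ≡⟨ cong (λ s → parity (take p u ++ s)) (sym (take-++-≤ p (drop p u) (take p u) p≤length-drop)) ⟩
        parity (take p u ++ take p (drop p u ++ take p u))
          ≡⟨ cong (λ s → parity (take p u ++ take p s)) (take-period p (<⇒≤ p<n) (proj₂ period)) ⟩
        parity (take p u ++ take p u)             ≡⟨ parity-doubled (take p u) ⟩
        false ∎

    not-above-half : n < p + p → ⊥
    not-above-half n<pp = shortest r r<p (m<n⇒0<n∸m n<pp , fixed-r)
      where
      r : ℕ
      r = p + p ∸ n
      n+r≡pp : n + r ≡ p + p
      n+r≡pp = m+[n∸m]≡n (<⇒≤ n<pp)
      r<p : r < p
      r<p = +-cancelˡ-< n r p (subst (_< n + p) (sym n+r≡pp) (+-monoˡ-< p p<n))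
      fixed-r : rot r u ≡ u
      fixed-r = begin
        rot r u           ≡⟨ cong (rot r) (sym rot-n) ⟩
        rot r (rot n u)   ≡⟨ sym (rot-+ n r u) ⟩
        rot (n + r) u     ≡⟨ cong (λ m → rot m u) n+r≡pp ⟩
        rot (p + p) u     ≡⟨ proj₂ (period-+ p p period period) ⟩
        u ∎

    at-half : p + p ≡ n → InÑ⁺ u
    at-half pp≡n = inj₂ (z , u≡zz , z-primitive , z-odd)
      where
      z : List Bool
      z = take p u
      length-z : length z ≡ p
      length-z = length-take-≤ p u p≤length
      u≡zz : u ≡ z ++ z
      u≡zz = begin
        u                   ≡⟨ sym (take++drop≡id p u) ⟩
        z ++ drop p u       ≡⟨ cong (λ s → z ++ drop p s) (sym (take-period p (<⇒≤ p<n) (proj₂ period))) ⟩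
        z ++ drop p (drop p u ++ z) ≡⟨ cong (λ m → z ++ drop m (drop p u ++ z)) (sym length-drop-u) ⟩
        z ++ drop (length (drop p u)) (drop p u ++ z) ≡⟨ cong (z ++_) (drop-length-++ (drop p u) z) ⟩
        z ++ z ∎
        where
        length-drop-u : length (drop p u) ≡ p
        length-drop-u = trans (length-drop p u) (trans (cong (_∸ p) (trans length-u (sym pp≡n))) (m+n∸m≡n p p))
      z-primitive : Primitive z
      z-primitive r 0<r r<p fixed = shortest r (subst (r <_) length-z r<p) (0<r ,
        trans (cong (rot r) u≡zz) (trans (rot-doubled r z (<⇒≤ r<p)) (trans (cong₂ _++_ fixed fixed) (sym u≡zz))))
      z-odd : OddOnes z
      z-odd = parity≡true⇒OddOnes z (period-odd p (proj₁ period) p<n (proj₂ period))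

  inÑ⁺ : InÑ⁺ u
  inÑ⁺ with searchLeast Period period? n
  ... | inj₂ aperiodic = inj₁ ((λ r 0<r r<l fixed → aperiodic r (subst (r <_) length-u r<l) (0<r , fixed)) ,
                               parity≡false⇒EvenOnes u even)
  ... | inj₁ (leastAt p p<n period shortest) with <-cmp (p + p) n
  ...   | tri< pp<n _ _ = ⊥-elim (ShortestPeriod.not-below-half p p<n period shortest pp<n)
  ...   | tri≈ _ pp≡n _ = ShortestPeriod.at-half p p<n period shortest pp≡n
  ...   | tri> _ _ n<pp = ⊥-elim (ShortestPeriod.not-above-half p p<n period shortest n<pp)

doubled-period : ∀ z → Primitive z → ∀ j → 0 < j → j < length z + length z →
  rot j (z ++ z) ≡ z ++ z → j ≡ length z
doubled-period z z-primitive j 0<j j<hh fixed with <-cmp j (length z)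
... | tri< j<h _ _ = ⊥-elim (z-primitive j 0<j j<h (rot-doubled-fixed j z (<⇒≤ j<h) fixed))
... | tri≈ _ j≡h _ = j≡h
... | tri> _ _ h<j = ⊥-elim (z-primitive j′ (m<n⇒0<n∸m h<j) j′<h (rot-doubled-fixed j′ z (<⇒≤ j′<h) fixed′))
  where
  h : ℕ
  h = length z
  j′ : ℕ
  j′ = j ∸ h
  h+j′≡j : h + j′ ≡ j
  h+j′≡j = m+[n∸m]≡n (<⇒≤ h<j)
  j′<h : j′ < h
  j′<h = +-cancelˡ-< h j′ h (subst (_< h + h) (sym h+j′≡j) j<hh)
  fixed′ : rot j′ (z ++ z) ≡ z ++ z
  fixed′ = begin
    rot j′ (z ++ z)            ≡⟨ cong (rot j′) (sym (rot-++ z z)) ⟩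
    rot j′ (rot h (z ++ z))    ≡⟨ sym (rot-+ h j′ (z ++ z)) ⟩
    rot (h + j′) (z ++ z)      ≡⟨ cong (λ m → rot m (z ++ z)) h+j′≡j ⟩
    rot j (z ++ z)             ≡⟨ fixed ⟩
    z ++ z ∎

Ñ⁺⇒oddComplements : ∀ n s → length s ≡ n → InÑ⁺ s → ∀ r → OddComplements n (rot r s)
Ñ⁺⇒oddComplements n s length-s (inj₁ (s-primitive , _)) r j 0<j j<n fixed =
  ⊥-elim (s-primitive j 0<j (subst (j <_) (sym length-s) j<n) (rot-injective r (trans (rot-comm r j s) fixed)))
Ñ⁺⇒oddComplements n s length-s (inj₂ (z , refl , z-primitive , z-odd)) r j 0<j j<n fixed
  with doubled-period z z-primitive j 0<j (subst (j <_) (trans (sym length-s) (length-++ z)) j<n)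
                      (rot-injective r (trans (rot-comm r j (z ++ z)) fixed))
... | refl = begin
  parity (take (n ∸ h) (rot r (z ++ z)))
    ≡⟨ cong₂ (λ m s → parity (take m s)) n∸h≡h (periodic-% doubled-periodic {{>-nonZero 0<j}} r) ⟩
  parity (take h (rot r′ (z ++ z)))
    ≡⟨ cong (parity ∘ take h) (rot-doubled r′ z (<⇒≤ (m%n<n r h {{>-nonZero 0<j}}))) ⟩
  parity (take h (rot r′ z ++ rot r′ z))
    ≡⟨ cong (λ m → parity (take m (rot r′ z ++ rot r′ z))) (sym (length-rot r′ z)) ⟩
  parity (take (length (rot r′ z)) (rot r′ z ++ rot r′ z)) ≡⟨ cong parity (take-length-++ (rot r′ z) (rot r′ z)) ⟩
  parity (rot r′ z)                          ≡⟨ parity-rot r′ z ⟩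
  parity z                                   ≡⟨ OddOnes⇒parity≡true z z-odd ⟩
  true ∎
  where
  h : ℕ
  h = length z
  r′ : ℕ
  r′ = _%_ r h {{>-nonZero 0<j}}
  n∸h≡h : n ∸ h ≡ h
  n∸h≡h = trans (cong (_∸ h) (trans (sym length-s) (length-++ z))) (m+n∸m≡n h h)
  doubled-periodic : Periodic h (λ m → rot m (z ++ z))
  doubled-periodic m = trans (rot-+ h m (z ++ z)) (cong (rot m) (rot-++ z z))


-- Itineraries of a cyclic unimodal permutation

module _ {n : ℕ} (σ : Permutation′ n) where

  ^-+ : ∀ a b x → σ ^ (a + b) · x ≡ σ ^ a · (σ ^ b · x)
  ^-+ zero    b x = refl
  ^-+ (suc a) b x = cong (σ ⟨$⟩ʳ_) (^-+ a b x)

  ^-suc : ∀ t x → σ ^ suc t · x ≡ σ ^ t · (σ ⟨$⟩ʳ x)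
  ^-suc t x = trans (cong (λ s → σ ^ s · x) (+-comm 1 t)) (^-+ t 1 x)

  ⟨$⟩ʳ-injective : ∀ {x y} → σ ⟨$⟩ʳ x ≡ σ ⟨$⟩ʳ y → x ≡ y
  ⟨$⟩ʳ-injective {x} {y} σx≡σy = trans (sym (inverseˡ σ)) (trans (cong (σ ⟨$⟩ˡ_) σx≡σy) (inverseˡ σ))

  ^-injective : ∀ t {x y} → σ ^ t · x ≡ σ ^ t · y → x ≡ y
  ^-injective zero    same = same
  ^-injective (suc t) same = ^-injective t (⟨$⟩ʳ-injective same)

<⇒<ᵇ≡true : ∀ a b → a < b → (a <ᵇ b) ≡ true
<⇒<ᵇ≡true zero    (suc b) _         = refl
<⇒<ᵇ≡true (suc a) (suc b) (s≤s a<b) = <⇒<ᵇ≡true a b a<b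

≥⇒<ᵇ≡false : ∀ a b → b ≤ a → (a <ᵇ b) ≡ false
≥⇒<ᵇ≡false a       zero    _         = refl
≥⇒<ᵇ≡false (suc a) (suc b) (s≤s b≤a) = ≥⇒<ᵇ≡false a b b≤a

module _ {k : ℕ} (σ : Permutation′ (suc k)) where

  Ainit≡applyUpTo : Ainit σ ≡ applyUpTo (itinBit σ ∘ suc) k
  Ainit≡applyUpTo = trans (cong (map (itinBit σ)) (map-upTo suc k)) (map-applyUpTo suc (itinBit σ) k)

  length-Ainit : length (Ainit σ) ≡ k
  length-Ainit = trans (cong length Ainit≡applyUpTo) (length-applyUpTo (itinBit σ ∘ suc) k)

  length-A : length (A σ) ≡ suc k
  length-A = trans (length-++ (Ainit σ)) (trans (cong (_+ 1) length-Ainit) (+-comm k 1))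

  nth-Ainit : ∀ t → t < k → nth t (Ainit σ) ≡ itinBit σ (suc t)
  nth-Ainit t t<k = trans (cong (nth t) Ainit≡applyUpTo) (nth-applyUpTo (itinBit σ ∘ suc) k t t<k)

  cyclic-A : ∀ t → t < k → cyclic (A σ) t ≡ itinBit σ (suc t)
  cyclic-A t t<k = begin
    cyclic (A σ) t   ≡⟨ cyclic≡nth (A σ) t (subst (t <_) (sym length-A) (m≤n⇒m≤1+n t<k)) ⟩
    nth t (A σ)      ≡⟨ nth-++ t (Ainit σ) _ (subst (t <_) (sym length-Ainit) t<k) ⟩
    nth t (Ainit σ)  ≡⟨ nth-Ainit t t<k ⟩
    itinBit σ (suc t) ∎

  A-periodic : Periodic (suc k) (cyclic (A σ))
  A-periodic = subst (λ l → Periodic l (cyclic (A σ))) length-A (cyclic-periodic (A σ))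

module CyclicUnimodal (k : ℕ) (σ : Permutation′ (suc k)) (cup : IsCUP σ) where

  m : Fin (suc k)
  m = mPt σ

  σm≡0 : σ ⟨$⟩ʳ m ≡ fzero
  σm≡0 = inverseʳ σ

  orbit : ℕ → Fin (suc k)
  orbit a = σ ^ a · m

  turning : Fin (suc k)
  turning = proj₁ (proj₂ cup)

  turning≡m : turning ≡ m
  turning≡m = by-trichotomy (<-cmp (toℕ turning) (toℕ m))
    where
    below-0 : toℕ (σ ⟨$⟩ʳ turning) < toℕ (σ ⟨$⟩ʳ m) → ⊥
    below-0 = n≮0 ∘ subst (λ q → toℕ (σ ⟨$⟩ʳ turning) < toℕ q) σm≡0
    by-trichotomy : Tri (toℕ turning < toℕ m) (toℕ turning ≡ toℕ m) (toℕ m < toℕ turning) → turning ≡ m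
    by-trichotomy (tri≈ _ same _) = toℕ-injective same
    by-trichotomy (tri< t<m _ _) = ⊥-elim (below-0 (proj₂ (proj₂ (proj₂ cup)) turning m ≤-refl t<m))
    by-trichotomy (tri> _ _ m<t) = ⊥-elim (below-0 (proj₁ (proj₂ (proj₂ cup)) m turning m<t ≤-refl))

  decreasing : ∀ i j → toℕ i < toℕ j → toℕ j ≤ toℕ m → toℕ (σ ⟨$⟩ʳ j) < toℕ (σ ⟨$⟩ʳ i)
  decreasing i j i<j j≤m = proj₁ (proj₂ (proj₂ cup)) i j i<j (subst (λ q → toℕ j ≤ toℕ q) (sym turning≡m) j≤m)

  increasing : ∀ i j → toℕ m ≤ toℕ i → toℕ i < toℕ j → toℕ (σ ⟨$⟩ʳ i) < toℕ (σ ⟨$⟩ʳ j)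
  increasing i j m≤i i<j = proj₂ (proj₂ (proj₂ cup)) i j (subst (λ q → toℕ q ≤ toℕ i) (sym turning≡m) m≤i) i<j

  orbit-reaches : ∀ y → ∃[ a ] orbit a ≡ y
  orbit-reaches = proj₁ cup m

  orbit-return-periodic : ∀ d → orbit d ≡ m → Periodic d orbit
  orbit-return-periodic d returns t = begin
    σ ^ (d + t) · m        ≡⟨ cong (λ s → σ ^ s · m) (+-comm d t) ⟩
    σ ^ (t + d) · m        ≡⟨ ^-+ σ t d m ⟩
    σ ^ t · (σ ^ d · m)    ≡⟨ cong (σ ^ t ·_) returns ⟩
    σ ^ t · m ∎

  -- Otherwise the orbit of m would fit in fewer than k + 1 points.
  return-time-≥ : ∀ d → 0 < d → orbit d ≡ m → suc k ≤ d
  return-time-≥ d 0<d returns = injective⇒≤ index-injective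
    where
    instance
      d-nonZero : NonZero d
      d-nonZero = >-nonZero 0<d
    index : Fin (suc k) → Fin d
    index y = fromℕ< (m%n<n (proj₁ (orbit-reaches y)) d)
    orbit-index : ∀ y → orbit (toℕ (index y)) ≡ y
    orbit-index y = begin
      orbit (toℕ (index y))                ≡⟨ cong orbit (toℕ-fromℕ< (m%n<n (proj₁ (orbit-reaches y)) d)) ⟩
      orbit (proj₁ (orbit-reaches y) % d)  ≡⟨ sym (periodic-% (orbit-return-periodic d returns) _) ⟩
      orbit (proj₁ (orbit-reaches y))      ≡⟨ proj₂ (orbit-reaches y) ⟩
      y ∎
    index-injective : ∀ {y z} → index y ≡ index z → y ≡ z
    index-injective {y} {z} same = trans (sym (orbit-index y)) (trans (cong (orbit ∘ toℕ) same) (orbit-index z))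

  orbit-returns : orbit (suc k) ≡ m
  orbit-returns with pigeonhole ≤-refl (λ (i : Fin (suc (suc k))) → orbit (toℕ i))
  ... | i , j , i<j , same = subst (λ d → orbit d ≡ m) d≡n returns
    where
    d : ℕ
    d = toℕ j ∸ toℕ i
    returns : orbit d ≡ m
    returns = ^-injective σ (toℕ i) (begin
      σ ^ toℕ i · orbit d    ≡⟨ sym (^-+ σ (toℕ i) d m) ⟩
      orbit (toℕ i + d)      ≡⟨ cong orbit (m+[n∸m]≡n (<⇒≤ i<j)) ⟩
      orbit (toℕ j)          ≡⟨ sym same ⟩
      orbit (toℕ i) ∎)
    d≡n : d ≡ suc k
    d≡n = ≤-antisym (≤-trans (m∸n≤m (toℕ j) (toℕ i)) (s≤s⁻¹ (toℕ<n j)))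
                    (return-time-≥ d (m<n⇒0<n∸m i<j) returns)

  orbit-periodic : Periodic (suc k) orbit
  orbit-periodic = orbit-return-periodic (suc k) orbit-returns

  orbit≢m : ∀ i → 0 < i → i < suc k → orbit i ≢ m
  orbit≢m i 0<i i<n returns = <⇒≱ i<n (return-time-≥ i 0<i returns)

  orbit-surjective : ∀ y → ∃[ a ] a < suc k × orbit a ≡ y
  orbit-surjective y = a % suc k , m%n<n a (suc k) , trans (sym (periodic-% orbit-periodic a)) (proj₂ (orbit-reaches y))
    where
    a : ℕ
    a = proj₁ (orbit-reaches y)

  side : Fin (suc k) → Letter
  side p with <-cmp (toℕ p) (toℕ m)
  ... | tri< _ _ _ = L
  ... | tri≈ _ _ _ = ⋆
  ... | tri> _ _ _ = R

  side≡L : ∀ p → side p ≡ L → toℕ p < toℕ m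
  side≡L p _ with <-cmp (toℕ p) (toℕ m)
  side≡L p _  | tri< p<m _ _ = p<m
  side≡L p () | tri≈ _ _ _
  side≡L p () | tri> _ _ _

  side≡⋆ : ∀ p → side p ≡ ⋆ → p ≡ m
  side≡⋆ p _ with <-cmp (toℕ p) (toℕ m)
  side≡⋆ p () | tri< _ _ _
  side≡⋆ p _  | tri≈ _ p≡m _ = toℕ-injective p≡m
  side≡⋆ p () | tri> _ _ _

  side≡R : ∀ p → side p ≡ R → toℕ m < toℕ p
  side≡R p _ with <-cmp (toℕ p) (toℕ m)
  side≡R p () | tri< _ _ _
  side≡R p () | tri≈ _ _ _
  side≡R p _  | tri> _ _ m<p = m<p

  side-m : side m ≡ ⋆
  side-m with <-cmp (toℕ m) (toℕ m)
  ... | tri< m<m _ _ = ⊥-elim (<-irrefl refl m<m)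
  ... | tri≈ _ _ _   = refl
  ... | tri> _ _ m<m = ⊥-elim (<-irrefl refl m<m)

  sides-ordered : ∀ p q {x y} → side p ≡ x → side q ≡ y → x <ᴸ y → toℕ p < toℕ q
  sides-ordered p q sp sq L<⋆ = subst (λ r → toℕ p < toℕ r) (sym (side≡⋆ q sq)) (side≡L p sp)
  sides-ordered p q sp sq L<R = <-trans (side≡L p sp) (side≡R q sq)
  sides-ordered p q sp sq ⋆<R = subst (λ r → toℕ r < toℕ q) (sym (side≡⋆ p sp)) (side≡R q sq)

  itinerary : Fin (suc k) → Stream
  itinerary p t = side (σ ^ t · p)

  Before : Bool → Fin (suc k) → Fin (suc k) → Set
  Before = Oriented (λ p q → toℕ p < toℕ q)

  Before-irrefl : ∀ f {p q} → p ≡ q → ¬ Before f p q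
  Before-irrefl false refl = <-irrefl refl
  Before-irrefl true  refl = <-irrefl refl

  before-by-sides : ∀ f p q → Oriented _<ᴸ_ f (side p) (side q) → Before f p q
  before-by-sides false p q x<y = sides-ordered p q refl refl x<y
  before-by-sides true  p q y<x = sides-ordered q p refl refl y<x

  before-on-left : ∀ f p q → side p ≡ L → side q ≡ L → Before (not f) (σ ⟨$⟩ʳ p) (σ ⟨$⟩ʳ q) → Before f p q
  before-on-left false p q sp sq σq<σp with <-cmp (toℕ p) (toℕ q)
  ... | tri< p<q _ _ = p<q
  ... | tri≈ _ p≡q _ = ⊥-elim (Before-irrefl true (cong (σ ⟨$⟩ʳ_) (toℕ-injective p≡q)) σq<σp)
  ... | tri> _ _ q<p = ⊥-elim (<-asym σq<σp (decreasing q p q<p (<⇒≤ (side≡L p sp))))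
  before-on-left true  p q sp sq σp<σq with <-cmp (toℕ p) (toℕ q)
  ... | tri< p<q _ _ = ⊥-elim (<-asym σp<σq (decreasing p q p<q (<⇒≤ (side≡L q sq))))
  ... | tri≈ _ p≡q _ = ⊥-elim (Before-irrefl false (cong (σ ⟨$⟩ʳ_) (toℕ-injective p≡q)) σp<σq)
  ... | tri> _ _ q<p = q<p

  before-on-right : ∀ f p q → side p ≡ R → side q ≡ R → Before f (σ ⟨$⟩ʳ p) (σ ⟨$⟩ʳ q) → Before f p q
  before-on-right false p q sp sq σp<σq with <-cmp (toℕ p) (toℕ q)
  ... | tri< p<q _ _ = p<q
  ... | tri≈ _ p≡q _ = ⊥-elim (Before-irrefl false (cong (σ ⟨$⟩ʳ_) (toℕ-injective p≡q)) σp<σq)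
  ... | tri> _ _ q<p = ⊥-elim (<-asym σp<σq (increasing q p (<⇒≤ (side≡R q sq)) q<p))
  before-on-right true  p q sp sq σq<σp with <-cmp (toℕ p) (toℕ q)
  ... | tri< p<q _ _ = ⊥-elim (<-asym σq<σp (increasing p q (<⇒≤ (side≡R p sp)) p<q))
  ... | tri≈ _ p≡q _ = ⊥-elim (Before-irrefl true (cong (σ ⟨$⟩ʳ_) (toℕ-injective p≡q)) σq<σp)
  ... | tri> _ _ q<p = q<p

  itinerary-suc : ∀ p t → itinerary p (suc t) ≡ itinerary (σ ⟨$⟩ʳ p) t
  itinerary-suc p t = cong side (^-suc σ t p)

  itinerary-order : ∀ N f p q → plexCompare N f (itinerary p) (itinerary q) ≡ lt → Before f p q
  itinerary-order (suc N) f p q itin< with side p ≟ᴸ side q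
  ... | no  sides≢ = before-by-sides f p q (compareLetters≡lt f (side p) (side q)
          (trans (sym (plexStep-distinct N f (side p) (side q) _ _ sides≢)) itin<))
  ... | yes sides≡ = same-side (side p) refl (sym sides≡) (itinerary-order N _ (σ ⟨$⟩ʳ p) (σ ⟨$⟩ʳ q) tails<)
    where
    tails< : plexCompare N (reverses (side p) xor f) (itinerary (σ ⟨$⟩ʳ p)) (itinerary (σ ⟨$⟩ʳ q)) ≡ lt
    tails< = begin
      plexCompare N (reverses (side p) xor f) (itinerary (σ ⟨$⟩ʳ p)) (itinerary (σ ⟨$⟩ʳ q))
        ≡⟨ sym (plexCompare-cong N _ (λ t _ → itinerary-suc p t) (λ t _ → itinerary-suc q t)) ⟩
      plexCompare N (reverses (side p) xor f) (itinerary p ∘ suc) (itinerary q ∘ suc)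
        ≡⟨ sym (plexStep-same N f (side p) _ _) ⟩
      plexStep N f (side p) (side p) (itinerary p ∘ suc) (itinerary q ∘ suc)
        ≡⟨ cong (λ y → plexStep N f (side p) y (itinerary p ∘ suc) (itinerary q ∘ suc)) sides≡ ⟩
      plexStep N f (side p) (side q) (itinerary p ∘ suc) (itinerary q ∘ suc)
        ≡⟨ itin< ⟩
      lt ∎
    same-side : ∀ x → side p ≡ x → side q ≡ x →
      Before (reverses x xor f) (σ ⟨$⟩ʳ p) (σ ⟨$⟩ʳ q) → Before f p q
    same-side L sp sq = before-on-left f p q sp sq
    same-side ⋆ sp sq = ⊥-elim ∘ Before-irrefl f (cong (σ ⟨$⟩ʳ_) (trans (side≡⋆ p sp) (sym (side≡⋆ q sq))))
    same-side R sp sq = before-on-right f p q sp sq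

  -- Both itineraries reach ⋆ when the orbit of p returns to m.
  itinerary-injective : ∀ p q → AgreeBelow (suc k) (itinerary p) (itinerary q) → p ≡ q
  itinerary-injective p q same with orbit-surjective p
  ... | zero  , _   , refl = sym (side≡⋆ q (trans (sym (same 0 z<s)) side-m))
  ... | suc a , a<n , refl =
    sym (^-injective σ t (trans (side≡⋆ (σ ^ t · q) (trans (sym (same t t<n)) side-return)) (sym returns)))
    where
    t : ℕ
    t = suc k ∸ suc a
    t<n : t < suc k
    t<n = ∸-monoʳ-< z<s (<⇒≤ a<n)
    returns : σ ^ t · orbit (suc a) ≡ m
    returns = trans (sym (^-+ σ t (suc a) m)) (trans (cong orbit (m∸n+n≡m (<⇒≤ a<n))) orbit-returns)
    side-return : itinerary (orbit (suc a)) t ≡ ⋆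
    side-return = trans (cong side returns) side-m

  itinerary-monotone : ∀ p q → toℕ p < toℕ q → plexCompare (suc k) false (itinerary p) (itinerary q) ≡ lt
  itinerary-monotone p q p<q = by-result _ refl
    where
    by-result : ∀ o → plexCompare (suc k) false (itinerary p) (itinerary q) ≡ o → o ≡ lt
    by-result lt _    = refl
    by-result eq same = ⊥-elim (<-irrefl (cong toℕ (itinerary-injective p q
                          (plexCompare≡eq⇒agree (suc k) false (itinerary p) (itinerary q) same))) p<q)
    by-result gt p>q  = ⊥-elim (<-asym p<q (itinerary-order (suc k) false q p
                          (trans (plexCompare-swap (suc k) false (itinerary q) (itinerary p)) (cong invert p>q))))

  side≢m : ∀ p → p ≢ m → side p ≡ letter (toℕ p <ᵇ toℕ m)
  side≢m p p≢m with <-cmp (toℕ p) (toℕ m)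
  ... | tri< p<m _ _ = cong letter (sym (<⇒<ᵇ≡true _ _ p<m))
  ... | tri≈ _ p≡m _ = ⊥-elim (p≢m (toℕ-injective p≡m))
  ... | tri> _ _ m<p = cong letter (sym (≥⇒<ᵇ≡false _ _ (<⇒≤ m<p)))

  side-orbit : ∀ t → t < k → side (orbit (suc t)) ≡ letter (itinBit σ (suc t))
  side-orbit t t<k = side≢m (orbit (suc t)) (orbit≢m (suc t) z<s (s≤s t<k))

  itinerary-orbit : ∀ a t → itinerary (orbit a) t ≡ side (orbit (t + a))
  itinerary-orbit a t = cong side (sym (^-+ σ t a m))

  ⋆-itinerary : Stream
  ⋆-itinerary = itinerary (orbit 1)

  ⋆-itinerary≈A : AgreeBelow k ⋆-itinerary (letter ∘ cyclic (A σ))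
  ⋆-itinerary≈A t t<k = begin
    itinerary (orbit 1) t          ≡⟨ itinerary-orbit 1 t ⟩
    side (orbit (t + 1))           ≡⟨ cong (side ∘ orbit) (+-comm t 1) ⟩
    side (orbit (suc t))           ≡⟨ side-orbit t t<k ⟩
    letter (itinBit σ (suc t))     ≡⟨ cong letter (sym (cyclic-A σ t t<k)) ⟩
    letter (cyclic (A σ) t) ∎

  ⋆-itinerary-k : ⋆-itinerary k ≡ ⋆
  ⋆-itinerary-k = trans (itinerary-orbit 1 k) (trans (cong (side ∘ orbit) (+-comm k 1)) (trans (cong side orbit-returns) side-m))

  open StarredWord k (cyclic (A σ)) ⋆-itinerary (A-periodic σ) ⋆-itinerary≈A ⋆-itinerary-k

  -- σ(m) is the point 1, below every other point of its orbit.
  ⋆-starMinimal : StarMinimal (suc k) ⋆-itinerary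
  ⋆-starMinimal j 0<j j<n = begin
    plexCompare (suc k) false ⋆-itinerary (shift j ⋆-itinerary)
      ≡⟨ plexCompare-cong (suc k) false {⋆-itinerary} {⋆-itinerary} (λ _ _ → refl) shifted ⟩
    plexCompare (suc k) false (itinerary (orbit 1)) (itinerary (orbit (suc j)))
      ≡⟨ itinerary-monotone (orbit 1) (orbit (suc j)) (subst (λ p → toℕ p < toℕ (orbit (suc j))) (sym σm≡0) 0<orbit) ⟩
    lt ∎
    where
    shifted : AgreeBelow (suc k) (shift j ⋆-itinerary) (itinerary (orbit (suc j)))
    shifted t _ = trans (itinerary-orbit 1 (j + t)) (trans (cong (side ∘ orbit) j+t+1≡t+[1+j]) (sym (itinerary-orbit (suc j) t)))
      where
      j+t+1≡t+[1+j] : j + t + 1 ≡ t + suc j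
      j+t+1≡t+[1+j] = trans (+-comm (j + t) 1) (trans (cong suc (+-comm j t)) (sym (+-suc t j)))
    0<orbit : 0 < toℕ (orbit (suc j))
    0<orbit with toℕ (orbit (suc j)) in toℕ≡
    ... | zero  = ⊥-elim (orbit≢m j 0<j j<n (⟨$⟩ʳ-injective σ (trans (toℕ-injective toℕ≡) (sym σm≡0))))
    ... | suc _ = z<s

  A-oddComplements : OddComplements (suc k) (A σ)
  A-oddComplements j 0<j j<n fixed =
    trans (sym (lParity-cyclic (suc k ∸ j) (A σ) (subst (suc k ∸ j ≤_) (sym (length-A σ)) (m∸n≤m (suc k) j))))
          (starMinimal⇒oddPeriods ⋆-starMinimal j 0<j j<n
            (λ t → trans (sym (cyclic-rot j (A σ) t)) (cong (λ s → cyclic s t) fixed)))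

  A-inÑ⁺ : InÑ⁺ (A σ)
  A-inÑ⁺ = EvenWord.inÑ⁺ (suc k) (A σ) (length-A σ) (parity-completed (Ainit σ)) A-oddComplements

  A-shiftMinimal : ShiftMinimal (suc k) (letter ∘ cyclic (A σ))
  A-shiftMinimal = starMinimal⇒shiftMinimal ⋆-starMinimal


-- Injectivity

StrictlyMonotone : ∀ {N} → (Fin N → Fin N) → Set
StrictlyMonotone h = ∀ p q → toℕ p < toℕ q → toℕ (h p) < toℕ (h q)

strictlyMonotone-≥ : ∀ {N} (h : Fin N → Fin N) → StrictlyMonotone h → ∀ p → toℕ p ≤ toℕ (h p)
strictlyMonotone-≥ {N} h monotone p =
  subst (λ r → toℕ p ≤ toℕ (h r)) (fromℕ<-toℕ p (toℕ<n p)) (at (toℕ p) (toℕ<n p))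
  where
  at : ∀ i (i<N : i < N) → i ≤ toℕ (h (fromℕ< i<N))
  at zero    _   = z≤n
  at (suc i) i<N = ≤-trans (s≤s (at i i′<N))
    (monotone (fromℕ< i′<N) (fromℕ< i<N) (subst₂ _<_ (sym (toℕ-fromℕ< i′<N)) (sym (toℕ-fromℕ< i<N)) ≤-refl))
    where
    i′<N : i < N
    i′<N = <-trans ≤-refl i<N

opposite-< : ∀ {N} {p q : Fin N} → toℕ p < toℕ q → toℕ (opposite q) < toℕ (opposite p)
opposite-< {N} {p} {q} p<q = subst₂ _<_ (sym (opposite-prop q)) (sym (opposite-prop p)) (∸-monoʳ-< (s≤s p<q) (toℕ<n q))

-- The lower bound applied to the conjugate of h by the order-reversing involution gives the upper bound.
strictlyMonotone⇒id : ∀ {N} (h : Fin N → Fin N) → StrictlyMonotone h → ∀ p → h p ≡ p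
strictlyMonotone⇒id h monotone p = toℕ-injective (≤-antisym upper (strictlyMonotone-≥ h monotone p))
  where
  h′ : Fin _ → Fin _
  h′ = opposite ∘ h ∘ opposite
  monotone′ : StrictlyMonotone h′
  monotone′ p q p<q = opposite-< (monotone (opposite q) (opposite p) (opposite-< p<q))
  upper : toℕ (h p) ≤ toℕ p
  upper = ≮⇒≥ λ p<hp → <⇒≱ (opposite-< p<hp)
    (subst (λ r → toℕ (opposite p) ≤ toℕ (opposite (h r))) (opposite-involutive p)
           (strictlyMonotone-≥ h′ monotone′ (opposite p)))

rot-% : ∀ k (u : List Bool) → length u ≡ suc k → ∀ r → rot r u ≡ rot (r % suc k) u
rot-% k u length-u = periodic-% (subst (λ l → Periodic l (λ r → rot r u)) length-u (rot-periodic u))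

-- Each of u, v is at most the other in the parity-lexicographic order, being a shift of it.
shiftMinimal-rotations-equal : ∀ k (u v : List Bool) → length u ≡ suc k → length v ≡ suc k →
  ShiftMinimal (suc k) (letter ∘ cyclic u) → ShiftMinimal (suc k) (letter ∘ cyclic v) → u ∼ v → u ≡ v
shiftMinimal-rotations-equal k u v length-u length-v u-minimal v-minimal (r , rot-r-u≡v)
  with r % suc k | m%n<n r (suc k) | trans (sym (rot-% k u length-u r)) rot-r-u≡v
... | zero     | _   | u≡v       = u≡v
... | suc r₀   | r<n | rot-u≡v = cyclic-ext u v (trans length-u (sym length-v)) λ t t<l →
  letter-injective (plexCompare≡eq⇒agree (suc k) false U V U≡V t (subst (t <_) length-u t<l))
  where
  r′ : ℕ
  r′ = suc r₀
  U V : Stream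
  U = letter ∘ cyclic u
  V = letter ∘ cyclic v
  V≈shift-U : ∀ t → V t ≡ shift r′ U t
  V≈shift-U t = cong letter (trans (cong (λ s → cyclic s t) (sym rot-u≡v)) (cyclic-rot r′ u t))
  j : ℕ
  j = suc k ∸ r′
  shift-V≈U : ∀ t → shift j V t ≡ U t
  shift-V≈U t = begin
    V (j + t)           ≡⟨ V≈shift-U (j + t) ⟩
    U (r′ + (j + t))    ≡⟨ cong U (trans (sym (+-assoc r′ j t)) (cong (_+ t) (m+[n∸m]≡n (<⇒≤ r<n)))) ⟩
    U (suc k + t)       ≡⟨ cong letter (subst (λ l → Periodic l (cyclic u)) length-u (cyclic-periodic u) t) ⟩
    U t ∎
  U≢>V : plexCompare (suc k) false U V ≢ gt
  U≢>V = u-minimal r′ r<n ∘ trans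
    (plexCompare-cong (suc k) false {U} {U} {shift r′ U} {V} (λ _ _ → refl) (λ t _ → sym (V≈shift-U t)))
  V≢>U : plexCompare (suc k) false V U ≢ gt
  V≢>U = v-minimal j (∸-monoʳ-< z<s (<⇒≤ r<n)) ∘ trans
    (plexCompare-cong (suc k) false {V} {V} {shift j V} {U} (λ _ _ → refl) (λ t _ → shift-V≈U t))
  U≡V : plexCompare (suc k) false U V ≡ eq
  U≡V = neither-lt-nor-gt _ (λ U<V → V≢>U (trans (plexCompare-swap (suc k) false V U) (cong invert U<V))) U≢>V

-- With A(σ) = A(τ) the points σ^a(m) and τ^a(m) have the same itinerary, so matching
-- them is order preserving by kneading theory, hence the identity.
module SameWord (k : ℕ) (σ τ : Permutation′ (suc k)) (σ-cup : IsCUP σ) (τ-cup : IsCUP τ) (A≡A : A σ ≡ A τ) where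
  module Cσ = CyclicUnimodal k σ σ-cup
  module Cτ = CyclicUnimodal k τ τ-cup

  itinBit-same : ∀ t → t < k → itinBit σ (suc t) ≡ itinBit τ (suc t)
  itinBit-same t t<k = trans (sym (cyclic-A σ t t<k)) (trans (cong (λ s → cyclic s t) A≡A) (cyclic-A τ t t<k))

  side-orbit-same : ∀ a → Cσ.side (Cσ.orbit a) ≡ Cτ.side (Cτ.orbit a)
  side-orbit-same = periodic-ext (cong Cσ.side ∘ Cσ.orbit-periodic) (cong Cτ.side ∘ Cτ.orbit-periodic) below
    where
    below : AgreeBelow (suc k) (Cσ.side ∘ Cσ.orbit) (Cτ.side ∘ Cτ.orbit)
    below zero    _         = trans Cσ.side-m (sym Cτ.side-m)
    below (suc t) (s≤s t<k) = trans (Cσ.side-orbit t t<k) (trans (cong letter (itinBit-same t t<k)) (sym (Cτ.side-orbit t t<k)))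

  itinerary-orbit-same : ∀ a t → Cσ.itinerary (Cσ.orbit a) t ≡ Cτ.itinerary (Cτ.orbit a) t
  itinerary-orbit-same a t = trans (Cσ.itinerary-orbit a t) (trans (side-orbit-same (t + a)) (sym (Cτ.itinerary-orbit a t)))

  index : Fin (suc k) → ℕ
  index p = proj₁ (Cσ.orbit-surjective p)

  orbit-index : ∀ p → Cσ.orbit (index p) ≡ p
  orbit-index p = proj₂ (proj₂ (Cσ.orbit-surjective p))

  match : Fin (suc k) → Fin (suc k)
  match p = Cτ.orbit (index p)

  itinerary-match : ∀ p t → Cτ.itinerary (match p) t ≡ Cσ.itinerary p t
  itinerary-match p t = trans (sym (itinerary-orbit-same (index p) t)) (cong (λ q → Cσ.itinerary q t) (orbit-index p))

  match-orbit : ∀ a → match (Cσ.orbit a) ≡ Cτ.orbit a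
  match-orbit a = Cτ.itinerary-injective _ _ λ t _ →
    trans (itinerary-match (Cσ.orbit a) t) (itinerary-orbit-same a t)

  match-monotone : StrictlyMonotone match
  match-monotone p q p<q = Cτ.itinerary-order (suc k) false (match p) (match q)
    (trans (plexCompare-cong (suc k) false (λ t _ → itinerary-match p t) (λ t _ → itinerary-match q t))
           (Cσ.itinerary-monotone p q p<q))

  σ≗τ : ∀ y → σ ⟨$⟩ʳ y ≡ τ ⟨$⟩ʳ y
  σ≗τ y = begin
    σ ⟨$⟩ʳ y                       ≡⟨ cong (σ ⟨$⟩ʳ_) (sym (orbit-index y)) ⟩
    Cσ.orbit (suc (index y))       ≡⟨ sym (match-id _) ⟩
    match (Cσ.orbit (suc (index y))) ≡⟨ match-orbit (suc (index y)) ⟩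
    τ ⟨$⟩ʳ Cτ.orbit (index y)      ≡⟨ cong (τ ⟨$⟩ʳ_) (match-id y) ⟩
    τ ⟨$⟩ʳ y ∎
    where
    match-id : ∀ p → match p ≡ p
    match-id = strictlyMonotone⇒id match match-monotone

A-injective : ∀ k (σ τ : Permutation′ (suc k)) → IsCUP σ → IsCUP τ → A σ ∼ A τ →
  ∀ x → σ ⟨$⟩ʳ x ≡ τ ⟨$⟩ʳ x
A-injective k σ τ σ-cup τ-cup A∼A = SameWord.σ≗τ k σ τ σ-cup τ-cup
  (shiftMinimal-rotations-equal k (A σ) (A τ) (length-A σ) (length-A τ)
     (CyclicUnimodal.A-shiftMinimal k σ σ-cup) (CyclicUnimodal.A-shiftMinimal k τ τ-cup) A∼A)


-- Realising a star-minimal stream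

count : (ℕ → Bool) → ℕ → ℕ
count P zero    = 0
count P (suc N) = count P N + (if P N then 1 else 0)

count-cong : ∀ P Q N → AgreeBelow N P Q → count P N ≡ count Q N
count-cong P Q zero    _  = refl
count-cong P Q (suc N) ag =
  cong₂ _+_ (count-cong P Q N (agreeBelow-≤ (n≤1+n N) ag)) (cong (λ b → if b then 1 else 0) (ag N ≤-refl))

Implies : (ℕ → Bool) → (ℕ → Bool) → ℕ → Set
Implies P Q N = ∀ j → j < N → P j ≡ true → Q j ≡ true

indicator-mono : ∀ b c → (b ≡ true → c ≡ true) → (if b then 1 else 0) ≤ (if c then 1 else 0)
indicator-mono true  c b⇒c rewrite b⇒c refl = ≤-refl
indicator-mono false c _   = z≤n

count-mono : ∀ P Q N → Implies P Q N → count P N ≤ count Q N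
count-mono P Q zero    _   = z≤n
count-mono P Q (suc N) P⇒Q =
  +-mono-≤ (count-mono P Q N (λ j j<N → P⇒Q j (m≤n⇒m≤1+n j<N))) (indicator-mono (P N) (Q N) (P⇒Q N ≤-refl))

count-strict : ∀ P Q N → Implies P Q N → ∀ j → j < N → P j ≡ false → Q j ≡ true → count P N < count Q N
count-strict P Q (suc N) P⇒Q j (s≤s j≤N) Pj Qj with m≤n⇒m<n∨m≡n j≤N
... | inj₁ j<N = +-mono-<-≤ (count-strict P Q N (λ i i<N → P⇒Q i (m≤n⇒m≤1+n i<N)) j j<N Pj Qj)
                            (indicator-mono (P N) (Q N) (P⇒Q N ≤-refl))
... | inj₂ refl rewrite Pj | Qj =
  +-mono-≤-< (count-mono P Q j (λ i i<j → P⇒Q i (m≤n⇒m≤1+n i<j))) (z<s {0})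

count-all : ∀ N → count (λ _ → true) N ≡ N
count-all zero    = refl
count-all (suc N) = trans (cong (_+ 1) (count-all N)) (+-comm N 1)

count-<-bound : ∀ P N j → j < N → P j ≡ false → count P N < N
count-<-bound P N j j<N Pj = subst (count P N <_) (count-all N)
  (count-strict P (λ _ → true) N (λ _ _ _ → refl) j j<N Pj refl)

count-none : ∀ P N → (∀ j → j < N → P j ≡ false) → count P N ≡ 0
count-none P zero    _    = refl
count-none P (suc N) none rewrite none N ≤-refl =
  trans (+-identityʳ _) (count-none P N (λ j j<N → none j (m≤n⇒m≤1+n j<N)))

injective⇒surjective : ∀ {N} (f : Fin N → Fin N) → (∀ {i j} → f i ≡ f j → i ≡ j) → ∀ y → ∃[ x ] f x ≡ y
injective⇒surjective {zero}  f f-injective ()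
injective⇒surjective {suc N} f f-injective y with any? (λ x → f x Data.Fin.≟ y)
... | yes found = found
... | no  missed = ⊥-elim (<-irrefl refl (injective⇒≤ (λ {i} {j} → f-injective ∘ punchOut-injective (y≢f i) (y≢f j))))
  where
  y≢f : ∀ x → y ≢ f x
  y≢f x y≡fx = missed (x , sym y≡fx)

isLt : Order → Bool
isLt lt = true
isLt eq = false
isLt gt = false

isLt⇒lt : ∀ o → isLt o ≡ true → o ≡ lt
isLt⇒lt lt _ = refl

-- A star-minimal periodic stream w is realised by the permutation that sends the rank of
-- each shift of w (in the parity-lexicographic order) to the rank of the next shift.
module Realisation (k : ℕ) (w : Stream) (w-periodic : Periodic (suc k) w)
  (w≢⋆ : ∀ t → t < k → w t ≢ ⋆) (w-⋆ : w k ≡ ⋆) (w-minimal : StarMinimal (suc k) w) where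

  compareShifts : ℕ → ℕ → Order
  compareShifts a b = plexCompare (suc k) false (shift a w) (shift b w)

  rank : ℕ → ℕ
  rank a = count (λ j → isLt (compareShifts j a)) (suc k)

  compareShifts-cong : ∀ {a a′ b b′} → AgreeBelow (suc k) (shift a w) (shift a′ w) →
    AgreeBelow (suc k) (shift b w) (shift b′ w) →
    compareShifts a b ≡ compareShifts a′ b′
  compareShifts-cong {a} {a′} {b} {b′} = plexCompare-cong (suc k) false {shift a w} {shift a′ w} {shift b w} {shift b′ w}

  compareShifts-swap : ∀ a b → compareShifts a b ≡ invert (compareShifts b a)
  compareShifts-swap a b = plexCompare-swap (suc k) false (shift a w) (shift b w)

  compareShifts-trans : ∀ a b c → compareShifts a b ≡ lt → compareShifts b c ≡ lt → compareShifts a c ≡ lt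
  compareShifts-trans a b c = plexCompare-trans (suc k) false (shift a w) (shift b w) (shift c w)

  compareShifts≡eq⇒agree : ∀ a b → compareShifts a b ≡ eq → AgreeBelow (suc k) (shift a w) (shift b w)
  compareShifts≡eq⇒agree a b = plexCompare≡eq⇒agree (suc k) false (shift a w) (shift b w)

  shift-+n : ∀ a t → shift (suc k + a) w t ≡ shift a w t
  shift-+n a t = trans (cong w (+-assoc (suc k) a t)) (w-periodic (a + t))

  shift-% : ∀ a → AgreeBelow (suc k) (shift (a % suc k) w) (shift a w)
  shift-% a t _ = sym (periodic-% (λ b → shift-+n b t) a)

  compareShifts-% : ∀ a → compareShifts (a % suc k) a ≡ eq
  compareShifts-% a = agree⇒plexCompare≡eq (suc k) false (shift-% a)

  rank-cong : ∀ a b → AgreeBelow (suc k) (shift a w) (shift b w) → rank a ≡ rank b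
  rank-cong a b ag = count-cong _ _ (suc k) λ j _ → cong isLt (compareShifts-cong {j} {j} {a} {b} (λ _ _ → refl) ag)

  rank<n : ∀ a → rank a < suc k
  rank<n a = count-<-bound _ (suc k) (a % suc k) (m%n<n a (suc k)) (cong isLt (compareShifts-% a))

  rank-< : ∀ a b → compareShifts a b ≡ lt → rank a < rank b
  rank-< a b a<b = count-strict _ _ (suc k)
    (λ j _ j<a → cong isLt (compareShifts-trans j a b (isLt⇒lt _ j<a) a<b))
    (a % suc k) (m%n<n a (suc k)) (cong isLt (compareShifts-% a))
    (cong isLt (trans (compareShifts-cong {a % suc k} {a} {b} {b} (shift-% a) (λ _ _ → refl)) a<b))

  rank-<⇒ : ∀ a b → rank a < rank b → compareShifts a b ≡ lt
  rank-<⇒ a b ra<rb = by-result _ refl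
    where
    by-result : ∀ o → compareShifts a b ≡ o → o ≡ lt
    by-result lt _    = refl
    by-result eq a≡b  = ⊥-elim (<-irrefl (rank-cong a b (compareShifts≡eq⇒agree a b a≡b)) ra<rb)
    by-result gt a>b  = ⊥-elim (<-asym ra<rb (rank-< b a (trans (compareShifts-swap b a) (cong invert a>b))))

  rank-≡⇒ : ∀ a b → rank a ≡ rank b → AgreeBelow (suc k) (shift a w) (shift b w)
  rank-≡⇒ a b ra≡rb = compareShifts≡eq⇒agree a b (by-result _ refl)
    where
    by-result : ∀ o → compareShifts a b ≡ o → o ≡ eq
    by-result eq _   = refl
    by-result lt a<b = ⊥-elim (<-irrefl ra≡rb (rank-< a b a<b))
    by-result gt a>b = ⊥-elim (<-irrefl (sym ra≡rb) (rank-< b a (trans (compareShifts-swap b a) (cong invert a>b))))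

  rank-+ : ∀ a b → rank a ≡ rank b → ∀ c → rank (c + a) ≡ rank (c + b)
  rank-+ a b ra≡rb c = rank-cong (c + a) (c + b) λ t _ → begin
    w (c + a + t)     ≡⟨ cong w (trans (+-assoc c a t) (m+[n+o]≡n+[m+o] c a t)) ⟩
    shift a w (c + t)
      ≡⟨ periodic-ext (periodic-shift w-periodic a) (periodic-shift w-periodic b) (rank-≡⇒ a b ra≡rb) (c + t) ⟩
    shift b w (c + t) ≡⟨ cong w (trans (sym (m+[n+o]≡n+[m+o] c b t)) (sym (+-assoc c b t))) ⟩
    w (c + b + t) ∎

  rank-+n : ∀ a → rank (suc k + a) ≡ rank a
  rank-+n a = rank-cong (suc k + a) a λ t _ → shift-+n a t

  -- Among the first k+1 shifts only the b-th has its ⋆ at position k - b.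
  shifts-differ : ∀ a b → a < b → b < suc k → shift a w (k ∸ b) ≢ shift b w (k ∸ b)
  shifts-differ a b a<b b<n same = w≢⋆ (a + (k ∸ b)) (subst (a + (k ∸ b) <_) b+[k∸b]≡k (+-monoˡ-< (k ∸ b) a<b))
    (trans same (trans (cong w b+[k∸b]≡k) w-⋆))
    where
    b+[k∸b]≡k : b + (k ∸ b) ≡ k
    b+[k∸b]≡k = m+[n∸m]≡n (s≤s⁻¹ b<n)

  rank-injective : ∀ a b → a < suc k → b < suc k → rank a ≡ rank b → a ≡ b
  rank-injective a b a<n b<n ra≡rb with <-cmp a b
  ... | tri≈ _ a≡b _ = a≡b
  ... | tri< a<b _ _ = ⊥-elim (shifts-differ a b a<b b<n (rank-≡⇒ a b ra≡rb (k ∸ b) (s≤s (m∸n≤m k b))))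
  ... | tri> _ _ b<a = ⊥-elim (shifts-differ b a b<a a<n (rank-≡⇒ b a (sym ra≡rb) (k ∸ a) (s≤s (m∸n≤m k a))))

  position : ℕ → Fin (suc k)
  position a = fromℕ< (rank<n a)

  toℕ-position : ∀ a → toℕ (position a) ≡ rank a
  toℕ-position a = toℕ-fromℕ< (rank<n a)

  position-≡ : ∀ a b → rank a ≡ rank b → position a ≡ position b
  position-≡ a b ra≡rb = toℕ-injective (trans (toℕ-position a) (trans ra≡rb (sym (toℕ-position b))))

  position-≡⇒ : ∀ a b → position a ≡ position b → rank a ≡ rank b
  position-≡⇒ a b same = trans (sym (toℕ-position a)) (trans (cong toℕ same) (toℕ-position b))

  position-onto : ∀ y → ∃[ x ] position (toℕ x) ≡ y
  position-onto = injective⇒surjective (position ∘ toℕ) λ {x} {y} same →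
    toℕ-injective (rank-injective (toℕ x) (toℕ y) (toℕ<n x) (toℕ<n y) (position-≡⇒ _ _ same))

  time : Fin (suc k) → ℕ
  time y = toℕ (proj₁ (position-onto y))

  time<n : ∀ y → time y < suc k
  time<n y = toℕ<n (proj₁ (position-onto y))

  position-time : ∀ y → position (time y) ≡ y
  position-time y = proj₂ (position-onto y)

  rank-time : ∀ a → rank (time (position a)) ≡ rank a
  rank-time a = position-≡⇒ _ _ (position-time (position a))

  next prev : Fin (suc k) → Fin (suc k)
  next y = position (suc (time y))
  prev y = position (time y + k)

  next-position : ∀ a → next (position a) ≡ position (suc a)
  next-position a = position-≡ _ _ (rank-+ _ _ (rank-time a) 1)

  prev-position : ∀ a → prev (position a) ≡ position (a + k)
  prev-position a = position-≡ _ _ (trans (cong rank (+-comm (time (position a)) k))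
                                   (trans (rank-+ _ _ (rank-time a) k) (cong rank (+-comm k a))))

  next-prev : ∀ y → next (prev y) ≡ y
  next-prev y = trans (next-position (time y + k))
    (trans (position-≡ _ _ (trans (cong (rank ∘ suc) (+-comm (time y) k)) (rank-+n (time y)))) (position-time y))

  prev-next : ∀ y → prev (next y) ≡ y
  prev-next y = trans (prev-position (suc (time y)))
    (trans (position-≡ _ _ (trans (cong (rank ∘ suc) (+-comm (time y) k)) (rank-+n (time y)))) (position-time y))

  ρ : Permutation′ (suc k)
  ρ = permutation next prev next-prev prev-next

  ρ^-position : ∀ t a → ρ ^ t · position a ≡ position (t + a)
  ρ^-position zero    a = refl
  ρ^-position (suc t) a = trans (cong (ρ ⟨$⟩ʳ_) (ρ^-position t a)) (next-position (t + a))

  ρ-cycle : IsSingleCycle ρ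
  ρ-cycle x y = t , (begin
    ρ ^ t · x                    ≡⟨ cong (ρ ^ t ·_) (sym (position-time x)) ⟩
    ρ ^ t · position (time x)    ≡⟨ ρ^-position t (time x) ⟩
    position (t + time x)        ≡⟨ cong position t+time-x≡n+time-y ⟩
    position (suc k + time y)    ≡⟨ position-≡ _ _ (rank-+n (time y)) ⟩
    position (time y)            ≡⟨ position-time y ⟩
    y ∎)
    where
    t : ℕ
    t = (suc k ∸ time x) + time y
    t+time-x≡n+time-y : t + time x ≡ suc k + time y
    t+time-x≡n+time-y = trans (+-assoc (suc k ∸ time x) (time y) (time x))
      (trans (cong ((suc k ∸ time x) +_) (+-comm (time y) (time x)))
        (trans (sym (+-assoc (suc k ∸ time x) (time x) (time y))) (cong (_+ time y) (m∸n+n≡m (<⇒≤ (time<n x))))))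

  shift-head : ∀ a → shift a w 0 ≡ w a
  shift-head a = cong w (+-identityʳ a)

  head-≤ : ∀ a b → compareShifts a b ≡ lt → w a ≤ᴸ w b
  head-≤ a b a<b = subst₂ _≤ᴸ_ (shift-head a) (shift-head b) (plexCompare-lt⇒head k (shift a w) (shift b w) a<b)

  compareShifts-by-head : ∀ a b → w a ≢ w b → compareShifts a b ≡ compareLetters false (w a) (w b)
  compareShifts-by-head a b differ = trans
    (plexCompare-firstDifference 0 (suc k) false (shift a w) (shift b w) z<s (λ _ ())
      (λ same → differ (trans (sym (shift-head a)) (trans same (shift-head b)))))
    (cong₂ (compareLetters false) (shift-head a) (shift-head b))

  compareShifts-tails : ∀ a b → plexCompare k false (shift a w ∘ suc) (shift b w ∘ suc) ≡ lt →
    compareShifts (suc a) (suc b) ≡ lt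
  compareShifts-tails a b tails< = begin
    compareShifts (suc a) (suc b)
      ≡⟨ plexCompare-cong (suc k) false {shift (suc a) w} {shift a w ∘ suc} {shift (suc b) w} {shift b w ∘ suc}
                          (λ t _ → cong w (sym (+-suc a t))) (λ t _ → cong w (sym (+-suc b t))) ⟩
    plexCompare (suc k) false (shift a w ∘ suc) (shift b w ∘ suc)
      ≡⟨ plexCompare-extend k (suc k) false _ _ (n≤1+n k) (lt≢eq ∘ trans (sym tails<)) ⟩
    plexCompare k false (shift a w ∘ suc) (shift b w ∘ suc)       ≡⟨ tails< ⟩
    lt ∎

  w≢⋆′ : ∀ a → a < suc k → a ≢ k → w a ≢ ⋆
  w≢⋆′ a a<n a≢k = w≢⋆ a (≤∧≢⇒< (s≤s⁻¹ a<n) a≢k)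

  rank-0 : rank 0 ≡ 0
  rank-0 = count-none _ (suc k) none
    where
    none : ∀ j → j < suc k → isLt (compareShifts j 0) ≡ false
    none zero    _         = cong isLt (plexCompare-refl (suc k) false w)
    none (suc j) (s≤s j<k) = cong isLt (trans (compareShifts-swap (suc j) 0) (cong invert (w-minimal (suc j) z<s (s≤s j<k))))

  rank-n : rank (suc k) ≡ 0
  rank-n = trans (cong rank (sym (+-identityʳ (suc k)))) (trans (rank-+n 0) rank-0)

  0<rank : ∀ a → a < k → 0 < rank (suc a)
  0<rank a a<k = subst (_< rank (suc a)) rank-0 (rank-< 0 (suc a) (w-minimal (suc a) z<s (s≤s a<k)))

  -- Shifts below the k-th start with L, so the next shifts come in reverse order;
  -- the k-th shift is followed by w itself, the least of all.
  rank-decreasing : ∀ a b → a < suc k → b < suc k → rank a < rank b → rank b ≤ rank k → rank (suc b) < rank (suc a)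
  rank-decreasing a b a<n b<n ra<rb rb≤rk with m≤n⇒m<n∨m≡n rb≤rk
  ... | inj₂ rb≡rk with rank-injective b k b<n ≤-refl rb≡rk
  ...   | refl = subst (_< rank (suc a)) (sym rank-n) (0<rank a (≤∧≢⇒< (s≤s⁻¹ a<n) λ { refl → <-irrefl refl ra<rb }))
  rank-decreasing a b a<n b<n ra<rb rb≤rk | inj₁ rb<rk =
    rank-< (suc b) (suc a) (compareShifts-tails b a (plexCompare-tails-L k (shift a w) (shift b w) a-L b-L a<b))
    where
    a<b : compareShifts a b ≡ lt
    a<b = rank-<⇒ a b ra<rb
    wb≡L : w b ≡ L
    wb≡L = ≤⋆⇒L (subst (w b ≤ᴸ_) w-⋆ (head-≤ b k (rank-<⇒ b k rb<rk)))
                (w≢⋆′ b b<n λ { refl → <-irrefl refl rb<rk })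
    a-L : shift a w 0 ≡ L
    a-L = trans (shift-head a) (≤L⇒L (subst (w a ≤ᴸ_) wb≡L (head-≤ a b a<b)))
    b-L : shift b w 0 ≡ L
    b-L = trans (shift-head b) wb≡L

  rank-increasing : ∀ a b → a < suc k → b < suc k → rank k ≤ rank a → rank a < rank b → rank (suc a) < rank (suc b)
  rank-increasing a b a<n b<n rk≤ra ra<rb with m≤n⇒m<n∨m≡n rk≤ra
  ... | inj₂ rk≡ra with rank-injective k a ≤-refl a<n rk≡ra
  ...   | refl = subst (_< rank (suc b)) (sym rank-n) (0<rank b (≤∧≢⇒< (s≤s⁻¹ b<n) λ { refl → <-irrefl refl ra<rb }))
  rank-increasing a b a<n b<n rk≤ra ra<rb | inj₁ rk<ra =
    rank-< (suc a) (suc b) (compareShifts-tails a b (plexCompare-tails-R k (shift a w) (shift b w) a-R b-R a<b))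
    where
    a<b : compareShifts a b ≡ lt
    a<b = rank-<⇒ a b ra<rb
    wa≡R : w a ≡ R
    wa≡R = ⋆≤⇒R (subst (_≤ᴸ w a) w-⋆ (head-≤ k a (rank-<⇒ k a rk<ra)))
                (w≢⋆′ a a<n λ { refl → <-irrefl refl rk<ra })
    a-R : shift a w 0 ≡ R
    a-R = trans (shift-head a) wa≡R
    b-R : shift b w 0 ≡ R
    b-R = trans (shift-head b) (R≤⇒R (subst (_≤ᴸ w b) wa≡R (head-≤ a b a<b)))

  toℕ≡rank-time : ∀ y → toℕ y ≡ rank (time y)
  toℕ≡rank-time y = trans (cong toℕ (sym (position-time y))) (toℕ-position (time y))

  ρ-unimodal : IsUnimodal ρ
  ρ-unimodal = position k , decreasing , increasing
    where
    decreasing : ∀ i j → toℕ i < toℕ j → toℕ j ≤ toℕ (position k) → toℕ (ρ ⟨$⟩ʳ j) < toℕ (ρ ⟨$⟩ʳ i)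
    decreasing i j i<j j≤turning = subst₂ _<_ (sym (toℕ-position _)) (sym (toℕ-position _))
      (rank-decreasing (time i) (time j) (time<n i) (time<n j)
        (subst₂ _<_ (toℕ≡rank-time i) (toℕ≡rank-time j) i<j)
        (subst₂ _≤_ (toℕ≡rank-time j) (toℕ-position k) j≤turning))
    increasing : ∀ i j → toℕ (position k) ≤ toℕ i → toℕ i < toℕ j → toℕ (ρ ⟨$⟩ʳ i) < toℕ (ρ ⟨$⟩ʳ j)
    increasing i j turning≤i i<j = subst₂ _<_ (sym (toℕ-position _)) (sym (toℕ-position _))
      (rank-increasing (time i) (time j) (time<n i) (time<n j)
        (subst₂ _≤_ (toℕ-position k) (toℕ≡rank-time i) turning≤i)
        (subst₂ _<_ (toℕ≡rank-time i) (toℕ≡rank-time j) i<j))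

  ρ-cup : IsCUP ρ
  ρ-cup = ρ-cycle , ρ-unimodal

  mPt-ρ : mPt ρ ≡ position k
  mPt-ρ = begin
    ρ ⟨$⟩ˡ fzero                       ≡⟨ cong (ρ ⟨$⟩ˡ_) (sym ρ-turning) ⟩
    ρ ⟨$⟩ˡ (ρ ⟨$⟩ʳ position k)          ≡⟨ inverseˡ ρ ⟩
    position k ∎
    where
    ρ-turning : ρ ⟨$⟩ʳ position k ≡ fzero
    ρ-turning = trans (next-position k) (toℕ-injective (trans (toℕ-position (suc k)) rank-n))

  itinBit-ρ : ∀ t → t < k → ∀ b → w t ≡ letter b → itinBit ρ (suc t) ≡ b
  itinBit-ρ t t<k b wt≡b = begin
    toℕ (ρ ^ suc t · mPt ρ) <ᵇ toℕ (mPt ρ)        ≡⟨ cong (λ p → toℕ (ρ ^ suc t · p) <ᵇ toℕ p) mPt-ρ ⟩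
    toℕ (ρ ^ suc t · position k) <ᵇ toℕ (position k)
      ≡⟨ cong₂ _<ᵇ_ (trans (cong toℕ (ρ^-position (suc t) k)) (toℕ-position _)) (toℕ-position k) ⟩
    rank (suc t + k) <ᵇ rank k
      ≡⟨ cong (_<ᵇ rank k) (trans (cong (rank ∘ suc) (+-comm t k)) (rank-+n t)) ⟩
    rank t <ᵇ rank k                               ≡⟨ by-letter b wt≡b ⟩
    b ∎
    where
    wt≢wk : ∀ {x} → w t ≡ x → x ≢ ⋆ → w t ≢ w k
    wt≢wk wt≡x x≢⋆ same = x≢⋆ (trans (sym wt≡x) (trans same w-⋆))
    by-letter : ∀ b → w t ≡ letter b → (rank t <ᵇ rank k) ≡ b
    by-letter true  wt≡L = <⇒<ᵇ≡true _ _ (rank-< t k (trans (compareShifts-by-head t k (wt≢wk wt≡L λ ()))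
                             (cong₂ (compareLetters false) wt≡L w-⋆)))
    by-letter false wt≡R = ≥⇒<ᵇ≡false _ _ (<⇒≤ (rank-< k t (trans (compareShifts-by-head k t (wt≢wk wt≡R (λ ()) ∘ sym))
                             (cong₂ (compareLetters false) w-⋆ wt≡R))))


-- Surjectivity

leastStream : ∀ M (V : ℕ → Stream) N → ∃[ r ] r < suc N × (∀ j → j < suc N → plexCompare M false (V r) (V j) ≢ gt)
leastStream M V zero = 0 , z<s , λ { zero _ r>r → gt≢eq (trans (sym r>r) (plexCompare-refl M false (V 0))) ; (suc j) (s≤s ()) }
leastStream M V (suc N) with leastStream M V N
... | r , r≤N , least = by-result _ refl
  where
  least′ : plexCompare M false (V r) (V (suc N)) ≢ gt → ∀ j → j < suc (suc N) → plexCompare M false (V r) (V j) ≢ gt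
  least′ r≤sN j (s≤s j≤sN) with m≤n⇒m<n∨m≡n j≤sN
  ... | inj₁ j≤N = least j j≤N
  ... | inj₂ refl = r≤sN
  by-result : ∀ o → plexCompare M false (V r) (V (suc N)) ≡ o →
    ∃[ r ] r < suc (suc N) × (∀ j → j < suc (suc N) → plexCompare M false (V r) (V j) ≢ gt)
  by-result lt r<sN = r , m≤n⇒m≤1+n r≤N , least′ λ r>sN → lt≢gt (trans (sym r<sN) r>sN)
  by-result eq r≡sN = r , m≤n⇒m≤1+n r≤N , least′ λ r>sN → gt≢eq (trans (sym r>sN) r≡sN)
  by-result gt r>sN = suc N , ≤-refl , new-least
    where
    sN<r : plexCompare M false (V (suc N)) (V r) ≡ lt
    sN<r = trans (plexCompare-swap M false (V (suc N)) (V r)) (cong invert r>sN)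
    new-least : ∀ j → j < suc (suc N) → plexCompare M false (V (suc N)) (V j) ≢ gt
    new-least j (s≤s j≤sN) with m≤n⇒m<n∨m≡n j≤sN
    ... | inj₁ j≤N = λ sN>j →
      lt≢gt (trans (sym (plexCompare-<-≤-trans M (V (suc N)) (V r) (V j) sN<r (least j j≤N))) sN>j)
    ... | inj₂ refl = λ sN>sN → gt≢eq (trans (sym sN>sN) (plexCompare-refl M false (V (suc N))))

≡ᵇ-refl : ∀ a → (a ≡ᵇ a) ≡ true
≡ᵇ-refl zero    = refl
≡ᵇ-refl (suc a) = ≡ᵇ-refl a

≢⇒≡ᵇ≡false : ∀ a b → a ≢ b → (a ≡ᵇ b) ≡ false
≢⇒≡ᵇ≡false zero    zero    a≢b = ⊥-elim (a≢b refl)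
≢⇒≡ᵇ≡false zero    (suc b) _   = refl
≢⇒≡ᵇ≡false (suc a) zero    _   = refl
≢⇒≡ᵇ≡false (suc a) (suc b) a≢b = ≢⇒≡ᵇ≡false a b (a≢b ∘ cong suc)

starred : ℕ → Stream → Stream
starred k U t = if t % suc k ≡ᵇ k then ⋆ else U t

length-drop-k : ∀ k (u : List Bool) → length u ≡ suc k → length (drop k u) ≡ 1
length-drop-k k u length-u = trans (length-drop k u) (trans (cong (_∸ k) length-u) (m+n∸n≡m 1 k))

completed-prefix : ∀ k u → length u ≡ suc k → parity u ≡ false → take k u ++ [ parity (take k u) ] ≡ u
completed-prefix k u length-u even with drop k u in drop≡
... | y ∷ [] = trans (cong (λ b → take k u ++ [ b ]) (sym y≡parity)) u≡take++y
  where
  u≡take++y : take k u ++ [ y ] ≡ u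
  u≡take++y = trans (cong (take k u ++_) (sym drop≡)) (take++drop≡id k u)
  y≡parity : y ≡ parity (take k u)
  y≡parity = xor-cancel (parity (take k u)) y
    (trans (sym (parity-++ (take k u) [ y ])) (trans (cong parity u≡take++y) even))
    where
    xor-cancel : ∀ p y → p xor (y xor false) ≡ false → y ≡ p
    xor-cancel false false _ = refl
    xor-cancel true  true  _ = refl
... | [] = ⊥-elim (0≢1+n (trans (sym (cong length drop≡)) (length-drop-k k u length-u)))
... | _ ∷ _ ∷ _ = ⊥-elim (0≢1+n (sym (suc-injective (trans (sym (cong length drop≡)) (length-drop-k k u length-u)))))

Ñ⁺⇒parity≡false : ∀ s → InÑ⁺ s → parity s ≡ false
Ñ⁺⇒parity≡false s (inj₁ (_ , even))        = EvenOnes⇒parity≡false s even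
Ñ⁺⇒parity≡false s (inj₂ (z , refl , _ , _)) = parity-doubled z

periodic-+-% : ∀ {A : Set} {n} .{{_ : NonZero n}} {f : ℕ → A} → Periodic n f → ∀ a t → f (a + t) ≡ f (a % n + t)
periodic-+-% {n = n} {f = f} f-periodic a t =
  periodic-% {f = λ b → f (b + t)} (λ b → trans (cong f (+-assoc n b t)) (f-periodic (b + t))) a

-- The rotation of s that is least in the parity-lexicographic order becomes A(ρ) for the
-- permutation ρ realising it with its last letter starred.
module MinimalRotation (k : ℕ) (s : List Bool) (length-s : length s ≡ suc k) (s-Ñ⁺ : InÑ⁺ s) where

  V : ℕ → Stream
  V r t = letter (cyclic s (r + t))

  r₀ : ℕ
  r₀ = proj₁ (leastStream (suc k) V k)

  r₀<n : r₀ < suc k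
  r₀<n = proj₁ (proj₂ (leastStream (suc k) V k))

  u : List Bool
  u = rot r₀ s

  length-u : length u ≡ suc k
  length-u = trans (length-rot r₀ s) length-s

  s-periodic : Periodic (suc k) (cyclic s)
  s-periodic = subst (λ l → Periodic l (cyclic s)) length-s (cyclic-periodic s)

  u-periodic : Periodic (suc k) (cyclic u)
  u-periodic = subst (λ l → Periodic l (cyclic u)) length-u (cyclic-periodic u)

  U : Stream
  U = letter ∘ cyclic u

  U-shiftMinimal : ShiftMinimal (suc k) U
  U-shiftMinimal j j<n U>shift = proj₂ (proj₂ (leastStream (suc k) V k)) ((r₀ + j) % suc k) (m%n<n (r₀ + j) (suc k))
    (trans (sym (plexCompare-cong (suc k) false {U} {V r₀} {shift j U} {V ((r₀ + j) % suc k)}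
                  (λ t _ → cong letter (cyclic-rot r₀ s t)) shifted)) U>shift)
    where
    shifted : AgreeBelow (suc k) (shift j U) (V ((r₀ + j) % suc k))
    shifted t _ = cong letter (trans (cyclic-rot r₀ s (j + t))
      (trans (cong (cyclic s) (sym (+-assoc r₀ j t))) (periodic-+-% s-periodic (r₀ + j) t)))

  w : Stream
  w = starred k U

  w-periodic : Periodic (suc k) w
  w-periodic t = cong₂ (λ b x → if b then ⋆ else x)
    (cong (_≡ᵇ k) (trans (cong (_% suc k) (+-comm (suc k) t)) ([m+n]%n≡m%n t (suc k))))
    (cong letter (u-periodic t))

  w≈U : AgreeBelow k w U
  w≈U t t<k = cong (λ b → if b then ⋆ else U t)
    (trans (cong (_≡ᵇ k) (m≤n⇒m%n≡m (<⇒≤ t<k))) (≢⇒≡ᵇ≡false t k (<⇒≢ t<k)))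

  w-⋆ : w k ≡ ⋆
  w-⋆ = cong (λ b → if b then ⋆ else U k) (trans (cong (_≡ᵇ k) (m≤n⇒m%n≡m {k} {k} ≤-refl)) (≡ᵇ-refl k))

  w≢⋆ : ∀ t → t < k → w t ≢ ⋆
  w≢⋆ t t<k = letter≢⋆ (cyclic u t) ∘ trans (sym (w≈U t t<k))

  open StarredWord k (cyclic u) w u-periodic w≈U w-⋆

  u-oddPeriods : OddPeriods
  u-oddPeriods j 0<j j<n j-periodic =
    trans (lParity-cyclic (suc k ∸ j) u (subst (suc k ∸ j ≤_) (sym length-u) (m∸n≤m (suc k) j)))
          (Ñ⁺⇒oddComplements (suc k) s length-s s-Ñ⁺ r₀ j 0<j j<n
            (cyclic-ext (rot j u) u (length-rot j u) λ t _ → trans (cyclic-rot j u t) (j-periodic t)))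

  open Realisation k w w-periodic w≢⋆ w-⋆ (shiftMinimal⇒starMinimal U-shiftMinimal u-oddPeriods)

  Ainit-ρ : Ainit ρ ≡ take k u
  Ainit-ρ = nth-ext (Ainit ρ) (take k u) (trans (length-Ainit ρ) (sym (length-take-≤ k u k≤length)))
    λ t t<l → nth-Ainit-ρ t (subst (t <_) (length-Ainit ρ) t<l)
    where
    k≤length : k ≤ length u
    k≤length = subst (k ≤_) (sym length-u) (n≤1+n k)
    nth-Ainit-ρ : ∀ t → t < k → nth t (Ainit ρ) ≡ nth t (take k u)
    nth-Ainit-ρ t t<k = begin
      nth t (Ainit ρ)     ≡⟨ nth-Ainit ρ t t<k ⟩
      itinBit ρ (suc t)   ≡⟨ itinBit-ρ t t<k (cyclic u t) (w≈U t t<k) ⟩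
      cyclic u t          ≡⟨ cyclic≡nth u t (<-≤-trans t<k k≤length) ⟩
      nth t u             ≡⟨ sym (nth-take t k u t<k) ⟩
      nth t (take k u) ∎

  A-ρ : A ρ ≡ u
  A-ρ = trans (cong (λ a → a ++ [ parity a ]) Ainit-ρ)
              (completed-prefix k u length-u (trans (parity-rot r₀ s) (Ñ⁺⇒parity≡false s s-Ñ⁺)))

  A-ρ∼s : A ρ ∼ s
  A-ρ∼s = suc k ∸ r₀ , (begin
    rot (suc k ∸ r₀) (A ρ)          ≡⟨ cong (rot (suc k ∸ r₀)) A-ρ ⟩
    rot (suc k ∸ r₀) (rot r₀ s)     ≡⟨ sym (rot-+ r₀ (suc k ∸ r₀) s) ⟩
    rot (r₀ + (suc k ∸ r₀)) s       ≡⟨ cong (λ r → rot r s) (trans (m+[n∸m]≡n (<⇒≤ r₀<n)) (sym length-s)) ⟩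
    rot (length s) s                ≡⟨ rot-length s ⟩
    s ∎)

  realisation : Σ (Permutation′ (suc k)) λ σ → IsCUP σ × A σ ∼ s
  realisation = ρ , ρ-cup , A-ρ∼s

theoremC : (k : ℕ) →
    ((σ : Permutation′ (suc k)) → IsCUP σ → InÑ⁺ (A σ))
    × ((σ τ : Permutation′ (suc k)) → IsCUP σ → IsCUP τ → A σ ∼ A τ →
         ∀ x → σ ⟨$⟩ʳ x ≡ τ ⟨$⟩ʳ x)
    × ((s : List Bool) → length s ≡ suc k → InÑ⁺ s →
         Σ (Permutation′ (suc k)) λ σ → IsCUP σ × A σ ∼ s)
theoremC k = CyclicUnimodal.A-inÑ⁺ k , A-injective k , MinimalRotation.realisation k
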